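{- Let $r\ge 1$ be real. If an $r$-cap exists, then $r\le R$; more specifically, there is a constant $b$ such that for every integer $k\ge 0$ there is a wall whose graph has clique number $k$ and which uses at least $rk-b$ colors (i.e. $|f(V)|\ge rk-b$).
   Context: All graphs are finite; intervals are convex subsets of $\mathbb{R}$. An interval graph is a graph $G=(V,E)$ with an assignment $v\mapsto I_v$ of intervals such that $uv\in E$ iff $u\ne v$ and $I_u\cap I_v\ne\emptyset$. $\omega(G)$ is the clique number, $N(v)$ the neighborhood, $N[v]=N(v)\cup\{v\}$, and $f(U)$ the image of a set $U$ under $f$. $R := \sup\{\chi_{FF}(G)/\omega(G) : G$ a nonempty finite interval graph$\}$, where $\chi_{FF}(G)$ is the maximum over vertex orderings of the number of colors used by first-fit (which colors vertices in order, each with the least positive integer not used on an earlier neighbor). A wall is a pair $(G,f)$ where $G$ is an interval graph on $V$ with a given interval representation, $f\colon V\to\{1,2,\dots\}$ is a proper coloring, and $f(N[v])\supseteq\{1,\dots,f(v)\}$ for all $v\in V$; its number of colors is $|f(V)|$. An $r$-cap is a tuple $(G,f,v\mapsto I_v, v\mapsto J_v, v\mapsto c_v)$ where: $G$ is a nonempty finite interval graph on $V$ with interval representation $v\mapsto I_v$; $f\colon V\to\{0,-1,-2,\dots\}$ is a proper coloring of $G$ with $f(v)=0$ for some $v$; for each $v$, $J_v\subseteq I_v$ is an interval of positive length, and for all $u,v$, $J_u\cap J_v\ne\emptyset$ implies $J_u=J_v$; and, writing $C_v := f(\{u\in V : I_u\cap J_v\ne\emptyset\})$, for each $v$ there is $c_v\in\{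 -1,-2,\dots\}$ with (emptiness) $C_v\cap(-\infty,c_v]=\emptyset$, (sparseness) $|C_v\cap(c_v,0]|\le -c_v/r$, and (support) $\mathbb{Z}\cap(c_v,f(v)]\subseteq f(N[v])$.
   Formalization: The parameter r is rational, and intervals are convex subsets of ℚ rather than of ℝ, so r-caps, walls and the interval graphs in the definition of R are taken over ℚ. -}

module Defs where

open import Data.Nat as ℕ using (ℕ)
open import Data.Integer as ℤ using (ℤ; +_)
open import Data.Rational as ℚ using (ℚ)
open import Data.Fin using (Fin)
open import Data.Fin.Properties using () renaming (_≟_ to _≟ᶠ_)
open import Data.List using (List; length; tabulate; deduplicate)
open import Data.List.Relation.Unary.All using (All)
open import Data.List.Relation.Unary.Unique.Propositional using (Unique)
open import Data.Product using (Σ; ∃; _×_; _,_)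
open import Data.Sum using (_⊎_)
open import Relation.Nullary using (¬_)
open import Relation.Binary.PropositionalEquality using (_≡_; _≢_)
open import Function.Definitions using (Injective)

-- The real line is modelled by ℚ.

ℕ→ℚ : ℕ → ℚ
ℕ→ℚ n = (+ n) ℚ./ 1

ℤ→ℚ : ℤ → ℚ
ℤ→ℚ z = z ℚ./ 1

record Interval : Set₁ where
  field
    mem    : ℚ → Set
    convex : ∀ {x y z} → mem x → mem z → x ℚ.≤ y → y ℚ.≤ z → mem y
open Interval public

Meets : Interval → Interval → Set
Meets I J = ∃ λ x → mem I x × mem J x

_⊆ᴵ_ : Interval → Interval → Set
I ⊆ᴵ J = ∀ x → mem I x → mem J x

_≐ᴵ_ : Interval → Interval → Set
I ≐ᴵ J = (I ⊆ᴵ J) × (J ⊆ᴵ I)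

PositiveLength : Interval → Set
PositiveLength I = ∃ λ x → ∃ λ y → x ℚ.< y × mem I x × mem I y

Rep : ℕ → Set₁
Rep n = Fin n → Interval

Adj : ∀ {n} → Rep n → Fin n → Fin n → Set
Adj I u v = u ≢ v × Meets (I u) (I v)

InClosedNbhd : ∀ {n} → Rep n → Fin n → Fin n → Set
InClosedNbhd I v u = u ≡ v ⊎ Adj I u v

-- subsets of vertices as duplicate-free lists
IsClique : ∀ {n} → Rep n → List (Fin n) → Set
IsClique I S = Unique S × All (λ u → All (λ v → u ≢ v → Adj I u v) S) S

CliqueNumber : ∀ {n} → Rep n → ℕ → Set
CliqueNumber I k =
  (∃ λ S → IsClique I S × length S ≡ k) ×
  (∀ S → IsClique I S → length S ℕ.≤ k)

imageSize : ∀ {n} {A : Set} → (∀ (a b : A) → Relation.Nullary.Dec (a ≡ b)) → (Fin n → A) → ℕ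
imageSize _≟_ g = length (deduplicate _≟_ (tabulate g))

ProperColoring : ∀ {n} {A : Set} → Rep n → (Fin n → A) → Set
ProperColoring I f = ∀ u v → Adj I u v → f u ≢ f v

record Wall (n : ℕ) : Set₁ where
  field
    rep      : Rep n
    col      : Fin n → ℕ
    positive : ∀ v → 1 ℕ.≤ col v
    proper   : ProperColoring rep col
    support  : ∀ v i → 1 ℕ.≤ i → i ℕ.≤ col v →
               ∃ λ u → InClosedNbhd rep v u × col u ≡ i

wallColors : ∀ {n} → Wall n → ℕ
wallColors W = imageSize ℕ._≟_ (Wall.col W)

-- Cardinality bound for an arbitrary set of integers:
-- |P| · r ≤ m  means every duplicate-free list of elements of P has
-- length ℓ with r·ℓ ≤ m.
ScaledCardLe : (ℤ → Set) → ℚ → ℚ → Set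
ScaledCardLe P r m = ∀ (xs : List ℤ) → Unique xs → All P xs → r ℚ.* ℕ→ℚ (length xs) ℚ.≤ m

record Cap (r : ℚ) : Set₁ where
  field
    n        : ℕ
    rep      : Rep n
    col      : Fin n → ℤ
    nonpos   : ∀ v → col v ℤ.≤ + 0
    proper   : ProperColoring rep col
    hasZero  : ∃ λ v → col v ≡ + 0
    J        : Fin n → Interval
    J⊆I      : ∀ v → J v ⊆ᴵ rep v
    Jpos     : ∀ v → PositiveLength (J v)
    Jdisj    : ∀ u v → Meets (J u) (J v) → J u ≐ᴵ J v
    c        : Fin n → ℤ
    c<0      : ∀ v → c v ℤ.< + 0
    emptiness  : ∀ v u → Meets (rep u) (J v) → ¬ (col u ℤ.≤ c v)
    -- |C_v ∩ (c_v, 0]| ≤ -c_v / r   (written as r·|…| ≤ -c_v, r > 0)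
    sparseness : ∀ v → ScaledCardLe
                   (λ i → (∃ λ u → Meets (rep u) (J v) × col u ≡ i) × c v ℤ.< i × i ℤ.≤ + 0)
                   r (ℤ→ℚ (ℤ.- c v))
    support    : ∀ v i → c v ℤ.< i → i ℤ.≤ col v →
                   ∃ λ u → InClosedNbhd rep v u × col u ≡ i

-- g is the first-fit coloring for the vertex ordering given by the
-- injective position map pos (u precedes v iff pos u < pos v):
-- g v is the least positive integer not used on an earlier neighbour.
IsFirstFit : ∀ {n} → Rep n → (pos : Fin n → ℕ) → (Fin n → ℕ) → Set
IsFirstFit I pos g =
  ∀ v → (1 ℕ.≤ g v)
      × (∀ u → Adj I u v → pos u ℕ.< pos v → g u ≢ g v)
      × (∀ i → 1 ℕ.≤ i → i ℕ.< g v → ∃ λ u → Adj I u v × pos u ℕ.< pos v × g u ≡ i)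

-- r ≤ R, where R = sup χ_FF(G)/ω(G) over nonempty finite interval graphs:
-- for every q < r there is such a G and a vertex ordering for which
-- first-fit uses more than q·ω(G) colors.
LeR : ℚ → Set₁
LeR r = ∀ q → q ℚ.< r →
  ∃ λ n → 1 ℕ.≤ n × Σ (Rep n) λ I → ∃ λ w → CliqueNumber I w ×
    Σ (Fin n → ℕ) λ pos → Injective _≡_ _≡_ pos ×
    Σ (Fin n → ℕ) λ g → IsFirstFit I pos g ×
      q ℚ.* ℕ→ℚ w ℚ.< ℕ→ℚ (imageSize ℕ._≟_ g)

-- Walls are built by induction on the number T of colours.  The wall with T colours
-- consists of the cap, whose vertex u is recoloured T + f(u), together with, inside
-- the window J_v of each vertex v, an affinely shrunk copy of the wall with T + c_v
-- colours.  Emptiness puts the cap colours above all colours in the window of v, the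
-- support of the cap supplies the colours between T + c_v and T + f(v), and sparseness
-- allows at most −c_v / r cap intervals over a point of J_v; so, inductively, no point
-- lies in more than (T + β) / r intervals, for a constant β.  Next to the wall with
-- ⌊rk − β⌋ colours, a clique of size k then fixes the clique number at k.  Ordering
-- the vertices of a wall by colour makes first-fit reproduce its colouring, whence
-- r ≤ R.  To keep everything decidable, each I_u is first shrunk to a closed segment
-- keeping the intersections that matter, and each J_v to a window, the windows being
-- pairwise disjoint.

module Submission where

open import Defs
open import Data.Nat using (ℕ)
open import Data.Rational using (ℚ; _≤_; _*_; _-_; 1ℚ)
open import Data.Product using (Σ; ∃; _×_)

open import Data.Nat as ℕ using (zero; suc; _∸_)
import Data.Nat.Properties as ℕP
open import Data.Nat.Coprimality using (1-coprimeTo) renaming (sym to coprime-sym)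
open import Data.Nat.Induction using (<-rec)
open import Data.Integer as ℤ using (ℤ; +_; -[1+_])
import Data.Integer.Properties as ℤP
open import Data.Fin as Fin using (Fin; toℕ)
import Data.Fin.Properties as FinP
open import Data.Rational as ℚ using (mkℚ; _<_; _+_; -_; 0ℚ; 1/_; _⊔_; *≤*; *<*)
import Data.Rational.Properties as ℚP
import Data.Rational.Unnormalised.Base as ℚᵘ
import Data.Rational.Unnormalised.Properties as ℚᵘP
open import Data.Rational.Solver using (module +-*-Solver)
open import Data.List using (List; []; _∷_; [_]; _++_; length; filter; map; concat; concatMap; tabulate; lookup; allFin; upTo; deduplicate)
import Data.List.Properties as LP
open import Data.List.Relation.Unary.All as All using (All; []; _∷_)
import Data.List.Relation.Unary.All.Properties as AllP
open import Data.List.Relation.Unary.Any as Any using (Any; here; there)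
import Data.List.Relation.Unary.Any.Properties as AnyP
open import Data.List.Relation.Unary.AllPairs as AllPairs using (AllPairs; []; _∷_)
import Data.List.Relation.Unary.AllPairs.Properties as AllPairsP
open import Data.List.Relation.Unary.Unique.Propositional using (Unique)
import Data.List.Relation.Unary.Unique.Propositional.Properties as UniqueP
open import Data.List.Relation.Binary.Subset.Propositional using (_⊆_)
open import Data.List.Membership.Propositional using (_∈_; find; lose)
open import Data.List.Membership.Propositional.Properties
  using (∈-∃++; ∈-lookup; ∈-tabulate⁺; ∈-deduplicate⁺; ∈-allFin; ∈-filter⁺; ∈-map⁻; ∈-upTo⁻)
open import Relation.Binary.Bundles using (DecTotalOrder)
import Data.List.Extrema (DecTotalOrder.totalOrder ℚP.≤-decTotalOrder) as Extrema
import Data.List.Extrema.Nat as ℕExtrema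
open import Data.Product using (_,_; proj₁; proj₂)
open import Data.Sum using (_⊎_; inj₁; inj₂) renaming ([_,_] to either)
open import Data.Bool using (true; false)
open import Data.Empty using (⊥-elim)
open import Function using (_∘_)
open import Function.Definitions using (Injective)
open import Level using (0ℓ)
open import Relation.Nullary using (¬_; Dec; does; yes; no)
open import Relation.Nullary.Decidable using (_×-dec_)
open import Relation.Unary using (Pred; Decidable)
open import Relation.Binary.Definitions using (Tri; tri<; tri≈; tri>)
open import Relation.Binary.PropositionalEquality
  using (_≡_; _≢_; refl; sym; trans; cong; cong₂; subst; subst₂; module ≡-Reasoning)

<⇒≱ : ∀ {p q} → p < q → ¬ q ≤ p
<⇒≱ p<q q≤p = ℚP.<-irrefl refl (ℚP.<-≤-trans p<q q≤p)

private
  integral : ℕ → ℚ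
  integral n = mkℚ (+ n) 0 (coprime-sym (1-coprimeTo n))

  ℕ→ℚ-normal : ∀ n → ℕ→ℚ n ≡ integral n
  ℕ→ℚ-normal n = ℚP.↥p/↧p≡p (integral n)

ℕ→ℚ-mono-≤ : ∀ {m n} → m ℕ.≤ n → ℕ→ℚ m ≤ ℕ→ℚ n
ℕ→ℚ-mono-≤ {m} {n} m≤n rewrite ℕ→ℚ-normal m | ℕ→ℚ-normal n =
  *≤* (subst₂ ℤ._≤_ (sym (ℤP.*-identityʳ (+ m))) (sym (ℤP.*-identityʳ (+ n))) (ℤ.+≤+ m≤n))

ℕ→ℚ-mono-< : ∀ {m n} → m ℕ.< n → ℕ→ℚ m < ℕ→ℚ n
ℕ→ℚ-mono-< {m} {n} m<n rewrite ℕ→ℚ-normal m | ℕ→ℚ-normal n =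
  *<* (subst₂ ℤ._<_ (sym (ℤP.*-identityʳ (+ m))) (sym (ℤP.*-identityʳ (+ n))) (ℤ.+<+ m<n))

ℕ→ℚ-cancel-≤ : ∀ {m n} → ℕ→ℚ m ≤ ℕ→ℚ n → m ℕ.≤ n
ℕ→ℚ-cancel-≤ {m} {n} m≤n = ℕP.≮⇒≥ λ n<m → <⇒≱ (ℕ→ℚ-mono-< {n} {m} n<m) m≤n

0≤ℕ→ℚ : ∀ n → 0ℚ ≤ ℕ→ℚ n
0≤ℕ→ℚ n = ℕ→ℚ-mono-≤ {0} {n} ℕ.z≤n

ℕ→ℚ-homo-+ : ∀ m n → ℕ→ℚ (m ℕ.+ n) ≡ ℕ→ℚ m + ℕ→ℚ n
ℕ→ℚ-homo-+ m n rewrite ℕ→ℚ-normal m | ℕ→ℚ-normal n | ℕ→ℚ-normal (m ℕ.+ n) =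
  ℚP.toℚᵘ-injective (ℚᵘP.≃-trans (ℚᵘ.*≡* cross) (ℚᵘP.≃-sym (ℚP.toℚᵘ-homo-+ (integral m) (integral n))))
  where
  cross : + (m ℕ.+ n) ℤ.* + 1 ≡ (+ m ℤ.* + 1 ℤ.+ + n ℤ.* + 1) ℤ.* + 1
  cross rewrite ℤP.*-identityʳ (+ m) | ℤP.*-identityʳ (+ n) | ℤP.*-identityʳ (+ m ℤ.+ + n) = refl

private
  i≤+∣i∣ : ∀ i → i ℤ.≤ + ℤ.∣ i ∣
  i≤+∣i∣ (+ n)    = ℤP.≤-refl
  i≤+∣i∣ -[1+ n ] = ℤ.-≤+

archimedean : ∀ q → ∃ λ n → q < ℕ→ℚ n
archimedean q@(mkℚ num d-1 _) = n , subst (q <_) (sym (ℕ→ℚ-normal n)) (*<* num<n)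
  where
  n = suc ℤ.∣ num ∣
  num<n : num ℤ.* + 1 ℤ.< + n ℤ.* + suc d-1
  num<n = begin-strict
    num ℤ.* + 1      ≡⟨ ℤP.*-identityʳ num ⟩
    num              ≤⟨ i≤+∣i∣ num ⟩
    + ℤ.∣ num ∣      <⟨ ℤ.+<+ (ℕP.n<1+n ℤ.∣ num ∣) ⟩
    + n              ≤⟨ ℤ.+≤+ (ℕP.m≤m*n n (suc d-1)) ⟩
    + n ℤ.* + suc d-1 ∎
    where open ℤP.≤-Reasoning

ℕ-floor : ∀ q → ∃ λ t → (ℕ→ℚ t ≤ q ⊎ t ≡ 0) × q < ℕ→ℚ (suc t)
ℕ-floor q = below (proj₁ (archimedean q)) (proj₂ (archimedean q))
  where
  below : ∀ n → q < ℕ→ℚ n → ∃ λ t → (ℕ→ℚ t ≤ q ⊎ t ≡ 0) × q < ℕ→ℚ (suc t)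
  below zero    q<0   = 0 , inj₂ refl , ℚP.<-trans q<0 (ℕ→ℚ-mono-< {0} {1} ℕP.≤-refl)
  below (suc n) q<n+1 with ℕ→ℚ n ℚP.≤? q
  ... | yes n≤q = n , inj₁ n≤q , q<n+1
  ... | no n≰q  = below n (ℚP.≰⇒> n≰q)

p<q⇒0<q-p : ∀ {p q} → p < q → 0ℚ < q - p
p<q⇒0<q-p {p} {q} p<q = subst (_< q - p) (ℚP.+-inverseʳ p) (ℚP.+-monoˡ-< (- p) p<q)

p+[q-p]≡q : ∀ p q → p + (q - p) ≡ q
p+[q-p]≡q p q = solve 2 (λ p q → p :+ (q :- p) := q) refl p q
  where open +-*-Solver

≤q-p⇒p+≤q : ∀ {p q r} → r ≤ q - p → p + r ≤ q
≤q-p⇒p+≤q {p} {q} r≤q-p = subst (p + _ ≤_) (p+[q-p]≡q p q) (ℚP.+-monoʳ-≤ p r≤q-p)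

p<p+q : ∀ p {q} → 0ℚ < q → p < p + q
p<p+q p 0<q = subst (_< p + _) (ℚP.+-identityʳ p) (ℚP.+-monoʳ-< p 0<q)

module _ {A : Set} where

  private
    ∈-remove : ∀ {x y : A} as bs → y ∈ as ++ x ∷ bs → y ≢ x → y ∈ as ++ bs
    ∈-remove []       bs (here y≡x)  y≢x = ⊥-elim (y≢x y≡x)
    ∈-remove []       bs (there y∈)  _   = y∈
    ∈-remove (a ∷ as) bs (here y≡a)  _   = here y≡a
    ∈-remove (a ∷ as) bs (there y∈)  y≢x = there (∈-remove as bs y∈ y≢x)

  unique-⊆⇒length≤ : ∀ {xs ys : List A} → Unique xs → xs ⊆ ys → length xs ℕ.≤ length ys
  unique-⊆⇒length≤ {[]} _ _ = ℕ.z≤n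
  unique-⊆⇒length≤ {x ∷ xs} (x∉xs ∷ xs!) xs⊆ys with ∈-∃++ (xs⊆ys (here refl))
  ... | as , bs , refl = begin
    suc (length xs)            ≤⟨ ℕ.s≤s (unique-⊆⇒length≤ xs! xs⊆as++bs) ⟩
    suc (length (as ++ bs))    ≡⟨ cong suc (LP.length-++ as) ⟩
    suc (length as ℕ.+ length bs) ≡⟨ ℕP.+-suc (length as) (length bs) ⟨
    length as ℕ.+ length (x ∷ bs) ≡⟨ LP.length-++ as ⟨
    length (as ++ x ∷ bs)      ∎
    where
    open ℕP.≤-Reasoning
    xs⊆as++bs : xs ⊆ as ++ bs
    xs⊆as++bs y∈xs = ∈-remove as bs (xs⊆ys (there y∈xs)) λ y≡x → All.lookup x∉xs y∈xs (sym y≡x)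

filter-map : ∀ {A B : Set} {P : Pred B 0ℓ} (P? : Decidable P) (f : A → B) xs →
             filter P? (map f xs) ≡ map f (filter (λ x → P? (f x)) xs)
filter-map P? f [] = refl
filter-map P? f (x ∷ xs) with does (P? (f x))
... | true  = cong (f x ∷_) (filter-map P? f xs)
... | false = filter-map P? f xs

AllPairs-lookup : ∀ {A : Set} {R : A → A → Set} {xs : List A} → (∀ {a b} → R a b → R b a) →
                  AllPairs R xs → ∀ {i j} → i ≢ j → R (lookup xs i) (lookup xs j)
AllPairs-lookup sym-R (Rx ∷ _) {Fin.zero} {Fin.zero} 0≢0 = ⊥-elim (0≢0 refl)
AllPairs-lookup sym-R (Rx ∷ _) {Fin.zero} {Fin.suc j} _ = All.lookup Rx (∈-lookup j)
AllPairs-lookup sym-R (Rx ∷ _) {Fin.suc i} {Fin.zero} _ = sym-R (All.lookup Rx (∈-lookup i))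
AllPairs-lookup sym-R (_ ∷ Rxs) {Fin.suc i} {Fin.suc j} i≢j =
  AllPairs-lookup sym-R Rxs λ i≡j → i≢j (cong Fin.suc i≡j)

AllPairs-map-All : ∀ {A : Set} {Q : A → Set} {R S : A → A → Set} {xs : List A} →
                   (∀ {a b} → Q a → Q b → R a b → S a b) → All Q xs → AllPairs R xs → AllPairs S xs
AllPairs-map-All f []         []         = []
AllPairs-map-All f (qx ∷ qxs) (Rx ∷ Rxs) =
  All.zipWith (λ (qy , xRy) → f qx qy xRy) (qxs , Rx) ∷ AllPairs-map-All f qxs Rxs

m∸o<n⇒m∸n<o : ∀ {m n o} → n ℕ.≤ m → m ℕ.∸ o ℕ.< n → m ℕ.∸ n ℕ.< o
m∸o<n⇒m∸n<o {m} {n} {o} n≤m m∸o<n =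
  ℕP.∸-cancelʳ-< {o} {m ℕ.∸ n} {m} (subst (m ℕ.∸ o ℕ.<_) (sym (ℕP.m∸[m∸n]≡n n≤m)) m∸o<n)

n<m∸o⇒o<m∸n : ∀ {m n o} → n ℕ.≤ m → n ℕ.< m ℕ.∸ o → o ℕ.< m ℕ.∸ n
n<m∸o⇒o<m∸n {m} {n} {o} n≤m n<m∸o =
  ℕP.∸-cancelʳ-< {m ℕ.∸ n} {o} {m} (subst (ℕ._< m ℕ.∸ o) (sym (ℕP.m∸[m∸n]≡n n≤m)) n<m∸o)

-- Coloured segments

record Segment : Set where
  constructor segment
  field
    left right : ℚ
    colour     : ℕ
open Segment public

Overlap : Segment → Segment → Set
Overlap a b = left a ≤ right b × left b ≤ right a

Overlap-sym : ∀ {a b} → Overlap a b → Overlap b a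
Overlap-sym (ab , ba) = ba , ab

Covers : Segment → ℚ → Set
Covers s x = left s ≤ x × x ≤ right s

covers? : ∀ x s → Dec (Covers s x)
covers? x s = (left s ℚP.≤? x) ×-dec (x ℚP.≤? right s)

⟦_⟧ : Segment → Interval
⟦ s ⟧ = record
  { mem    = Covers s
  ; convex = λ (l≤x , _) (_ , z≤r) x≤y y≤z → ℚP.≤-trans l≤x x≤y , ℚP.≤-trans y≤z z≤r
  }

Meets⇒Overlap : ∀ {a b} → Meets ⟦ a ⟧ ⟦ b ⟧ → Overlap a b
Meets⇒Overlap (x , (la≤x , x≤ra) , (lb≤x , x≤rb)) = ℚP.≤-trans la≤x x≤rb , ℚP.≤-trans lb≤x x≤ra

Overlap⇒Meets : ∀ {a b} → left a ≤ right a → left b ≤ right b → Overlap a b → Meets ⟦ a ⟧ ⟦ b ⟧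
Overlap⇒Meets {a} {b} a≠∅ b≠∅ (la≤rb , lb≤ra) = left a ⊔ left b ,
  (ℚP.p≤p⊔q (left a) (left b) , ℚP.⊔-lub a≠∅ lb≤ra) ,
  (ℚP.p≤q⊔p (left a) (left b) , ℚP.⊔-lub la≤rb b≠∅)

segments-meet : ∀ (A B : Interval) {a₁ a₂ b₁ b₂} →
  (∀ {x} → a₁ ≤ x → x ≤ a₂ → mem A x) → (∀ {x} → b₁ ≤ x → x ≤ b₂ → mem B x) →
  a₁ ≤ a₂ → b₁ ≤ b₂ → a₁ ≤ b₂ → b₁ ≤ a₂ → Meets A B
segments-meet A B {a₁} {a₂} {b₁} {b₂} ⊆A ⊆B a₁≤a₂ b₁≤b₂ a₁≤b₂ b₁≤a₂ = a₁ ⊔ b₁ ,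
  ⊆A (ℚP.p≤p⊔q a₁ b₁) (ℚP.⊔-lub a₁≤a₂ b₁≤a₂) , ⊆B (ℚP.p≤q⊔p a₁ b₁) (ℚP.⊔-lub a₁≤b₂ b₁≤b₂)

-- Helly's theorem on the line: the largest left end point is a common point.
pairwise-overlapping⇒common-point : ∀ {A : Set} (seg : A → Segment) {a₀ : A} {S : List A} →
  (∀ {a b} → a ∈ a₀ ∷ S → b ∈ a₀ ∷ S → left (seg a) ≤ right (seg b)) →
  ∃ λ x → All (λ a → Covers (seg a) x) (a₀ ∷ S)
pairwise-overlapping⇒common-point seg {a₀} {S} l≤r =
  left (seg top) , All.zip (lefts≤ , All.tabulate (l≤r top∈))
  where
  top = Extrema.argmax (λ a → left (seg a)) a₀ S
  lefts≤ : All (λ a → left (seg a) ≤ left (seg top)) (a₀ ∷ S)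
  lefts≤ = Extrema.f[⊥]≤f[argmax] {f = λ a → left (seg a)} a₀ S ∷ Extrema.f[xs]≤f[argmax] a₀ S
  top∈ : top ∈ a₀ ∷ S
  top∈ with Extrema.argmax-sel (λ a → left (seg a)) a₀ S
  ... | inj₁ top≡a₀ = here top≡a₀
  ... | inj₂ top∈S  = there top∈S

depth : ℚ → List Segment → ℕ
depth x ss = length (filter (covers? x) ss)

depth-++ : ∀ x ss ts → depth x (ss ++ ts) ≡ depth x ss ℕ.+ depth x ts
depth-++ x ss ts = trans (cong length (LP.filter-++ (covers? x) ss ts)) (LP.length-++ (filter (covers? x) ss))

depth≤length : ∀ x ss → depth x ss ℕ.≤ length ss
depth≤length x = LP.length-filter (covers? x)

depth-uncovered : ∀ {x ss} → All (λ s → ¬ Covers s x) ss → depth x ss ≡ 0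
depth-uncovered {x} none = cong length (LP.filter-none (covers? x) none)

depth-tabulate : ∀ x {m} (f : Fin m → Segment) →
                 depth x (tabulate f) ≡ length (filter (λ u → covers? x (f u)) (allFin m))
depth-tabulate x {m} f = begin
  depth x (tabulate f)                                     ≡⟨ cong (depth x) (LP.map-tabulate (λ u → u) f) ⟨
  depth x (map f (allFin m))                               ≡⟨ cong length (filter-map (covers? x) f (allFin m)) ⟩
  length (map f (filter (λ u → covers? x (f u)) (allFin m))) ≡⟨ LP.length-map f (filter (λ u → covers? x (f u)) (allFin m)) ⟩
  length (filter (λ u → covers? x (f u)) (allFin m))       ∎
  where open ≡-Reasoning

depth-concat-single : ∀ {x m} (f : Fin m → List Segment) v →
  (∀ u → u ≢ v → All (λ s → ¬ Covers s x) (f u)) → depth x (concat (tabulate f)) ≡ depth x (f v)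
depth-concat-single {x} {suc m} f Fin.zero others = begin
  depth x (f Fin.zero ++ concat (tabulate (f ∘ Fin.suc)))               ≡⟨ depth-++ x (f Fin.zero) _ ⟩
  depth x (f Fin.zero) ℕ.+ depth x (concat (tabulate (f ∘ Fin.suc)))     ≡⟨ cong (depth x (f Fin.zero) ℕ.+_) rest≡0 ⟩
  depth x (f Fin.zero) ℕ.+ 0                                             ≡⟨ ℕP.+-identityʳ _ ⟩
  depth x (f Fin.zero)                                                   ∎
  where
  open ≡-Reasoning
  rest≡0 = depth-uncovered (AllP.concat⁺ (AllP.tabulate⁺ λ u → others (Fin.suc u) λ ()))
depth-concat-single {x} {suc m} f (Fin.suc v) others = begin
  depth x (f Fin.zero ++ concat (tabulate (f ∘ Fin.suc)))               ≡⟨ depth-++ x (f Fin.zero) _ ⟩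
  depth x (f Fin.zero) ℕ.+ depth x (concat (tabulate (f ∘ Fin.suc)))     ≡⟨ cong₂ ℕ._+_ (depth-uncovered (others Fin.zero λ ())) rest ⟩
  depth x (f (Fin.suc v))                                                ∎
  where
  open ≡-Reasoning
  rest = depth-concat-single (f ∘ Fin.suc) v λ u u≢v → others (Fin.suc u) λ eq → u≢v (FinP.suc-injective eq)

module Affine {lo hi lo′ hi′ : ℚ} (lo<hi : lo < hi) (lo′<hi′ : lo′ < hi′) where

  private
    instance
      width>0 : ℚ.Positive (hi - lo)
      width>0 = ℚ.positive (p<q⇒0<q-p lo<hi)
      width≢0 : ℚ.NonZero (hi - lo)
      width≢0 = ℚP.pos⇒nonZero (hi - lo)
      width′>0 : ℚ.Positive (hi′ - lo′)
      width′>0 = ℚ.positive (p<q⇒0<q-p lo′<hi′)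

  slope : ℚ
  slope = (hi′ - lo′) * 1/ (hi - lo)

  private
    instance
      slope>0 : ℚ.Positive slope
      slope>0 = ℚP.pos*pos⇒pos (hi′ - lo′) (1/ (hi - lo)) {{ℚP.1/pos⇒pos (hi - lo)}}
      slope≢0 : ℚ.NonZero slope
      slope≢0 = ℚP.pos⇒nonZero slope

  φ : ℚ → ℚ
  φ x = lo′ + slope * (x - lo)

  ψ : ℚ → ℚ
  ψ y = lo + 1/ slope * (y - lo′)

  φ-mono-< : ∀ {x y} → x < y → φ x < φ y
  φ-mono-< x<y = ℚP.+-monoʳ-< lo′ (ℚP.*-monoʳ-<-pos slope (ℚP.+-monoˡ-< (- lo) x<y))

  φ-mono-≤ : ∀ {x y} → x ≤ y → φ x ≤ φ y
  φ-mono-≤ x≤y = ℚP.+-monoʳ-≤ lo′ (ℚP.*-monoˡ-≤-nonNeg slope {{ℚP.pos⇒nonNeg slope}} (ℚP.+-monoˡ-≤ (- lo) x≤y))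

  φ-cancel-≤ : ∀ {x y} → φ x ≤ φ y → x ≤ y
  φ-cancel-≤ φx≤φy = ℚP.≮⇒≥ λ y<x → <⇒≱ (φ-mono-< y<x) φx≤φy

  φ-lo : φ lo ≡ lo′
  φ-lo = begin
    lo′ + slope * (lo - lo) ≡⟨ cong (λ z → lo′ + slope * z) (ℚP.+-inverseʳ lo) ⟩
    lo′ + slope * 0ℚ        ≡⟨ cong (λ z → lo′ + z) (ℚP.*-zeroʳ slope) ⟩
    lo′ + 0ℚ                ≡⟨ ℚP.+-identityʳ lo′ ⟩
    lo′                     ∎
    where open ≡-Reasoning

  φ-hi : φ hi ≡ hi′
  φ-hi = begin
    lo′ + (hi′ - lo′) * 1/ (hi - lo) * (hi - lo)   ≡⟨ cong (λ z → lo′ + z) (ℚP.*-assoc (hi′ - lo′) _ _) ⟩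
    lo′ + (hi′ - lo′) * (1/ (hi - lo) * (hi - lo)) ≡⟨ cong (λ z → lo′ + (hi′ - lo′) * z) (ℚP.*-inverseˡ (hi - lo)) ⟩
    lo′ + (hi′ - lo′) * 1ℚ                        ≡⟨ solve 2 (λ a b → a :+ (b :- a) :* con 1ℚ := b) refl lo′ hi′ ⟩
    hi′                                           ∎
    where open ≡-Reasoning
          open +-*-Solver

  φ∘ψ : ∀ y → φ (ψ y) ≡ y
  φ∘ψ y = begin
    lo′ + slope * (lo + 1/ slope * (y - lo′) - lo) ≡⟨ cong (λ z → lo′ + slope * z)
                                                        (solve 3 (λ a b c → a :+ b :* c :- a := b :* c) refl lo (1/ slope) (y - lo′)) ⟩
    lo′ + slope * (1/ slope * (y - lo′))           ≡⟨ cong (λ z → lo′ + z) (sym (ℚP.*-assoc slope (1/ slope) (y - lo′))) ⟩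
    lo′ + slope * 1/ slope * (y - lo′)             ≡⟨ cong (λ z → lo′ + z * (y - lo′)) (ℚP.*-inverseʳ slope) ⟩
    lo′ + 1ℚ * (y - lo′)                           ≡⟨ solve 2 (λ a b → a :+ con 1ℚ :* (b :- a) := b) refl lo′ y ⟩
    y                                              ∎
    where open ≡-Reasoning
          open +-*-Solver

  rescale : Segment → Segment
  rescale s = segment (φ (left s)) (φ (right s)) (colour s)

  Overlap-rescale⁺ : ∀ {a b} → Overlap a b → Overlap (rescale a) (rescale b)
  Overlap-rescale⁺ (ab , ba) = φ-mono-≤ ab , φ-mono-≤ ba

  Overlap-rescale⁻ : ∀ {a b} → Overlap (rescale a) (rescale b) → Overlap a b
  Overlap-rescale⁻ (ab , ba) = φ-cancel-≤ ab , φ-cancel-≤ ba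

  Covers-rescale⁻ : ∀ {x s} → Covers (rescale s) x → Covers s (ψ x)
  Covers-rescale⁻ {x} {s} (l≤x , x≤r) =
    φ-cancel-≤ (subst (φ (left s) ≤_) (sym (φ∘ψ x)) l≤x) , φ-cancel-≤ (subst (_≤ φ (right s)) (sym (φ∘ψ x)) x≤r)

  Covers-rescale⁺ : ∀ {x s} → Covers s (ψ x) → Covers (rescale s) x
  Covers-rescale⁺ {x} {s} (l≤x , x≤r) =
    subst (φ (left s) ≤_) (φ∘ψ x) (φ-mono-≤ l≤x) , subst (_≤ φ (right s)) (φ∘ψ x) (φ-mono-≤ x≤r)

  depth-rescale : ∀ x ss → depth x (map rescale ss) ≡ depth (ψ x) ss
  depth-rescale x ss = begin
    length (filter (covers? x) (map rescale ss))      ≡⟨ cong length (filter-map (covers? x) rescale ss) ⟩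
    length (map rescale (filter covers-rescaled? ss)) ≡⟨ LP.length-map rescale (filter covers-rescaled? ss) ⟩
    length (filter covers-rescaled? ss)               ≡⟨ cong length (LP.filter-≐ covers-rescaled? (covers? (ψ x))
                                                           ((λ {s} → Covers-rescale⁻ {x} {s}) , (λ {s} → Covers-rescale⁺ {x} {s})) ss) ⟩
    depth (ψ x) ss                                    ∎
    where
    open ≡-Reasoning
    covers-rescaled? : ∀ s → Dec (Covers (rescale s) x)
    covers-rescaled? s = covers? x (rescale s)

-- Walls from lists of segments

Apart : Segment → Segment → Set
Apart a b = Overlap a b → colour a ≢ colour b

Proper : List Segment → Set
Proper = AllPairs Apart

Supported : List Segment → List Segment → Set
Supported ss ts = All (λ a → ∀ j → 1 ℕ.≤ j → j ℕ.< colour a → Any (λ b → Overlap a b × colour b ≡ j) ts) ss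

Uses : ℕ → List Segment → Set
Uses T ss = ∀ j → 1 ℕ.≤ j → j ℕ.≤ T → Any (λ s → colour s ≡ j) ss

record IsSegmentWall (ss : List Segment) : Set where
  field
    nonempty  : All (λ s → left s ≤ right s) ss
    positive  : All (λ s → 1 ℕ.≤ colour s) ss
    proper    : Proper ss
    supported : Supported ss ss

module SegmentWall {ss : List Segment} (isWall : IsSegmentWall ss) where
  open IsSegmentWall isWall

  n : ℕ
  n = length ss

  seg : Fin n → Segment
  seg = lookup ss

  rep : Rep n
  rep v = ⟦ seg v ⟧

  col : Fin n → ℕ
  col v = colour (seg v)

  seg-nonempty : ∀ v → left (seg v) ≤ right (seg v)
  seg-nonempty v = All.lookup nonempty (∈-lookup v)

  Overlap⇒Adj : ∀ {u v} → u ≢ v → Overlap (seg u) (seg v) → Adj rep u v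
  Overlap⇒Adj {u} {v} u≢v uv = u≢v , Overlap⇒Meets {seg u} {seg v} (seg-nonempty u) (seg-nonempty v) uv

  rep-proper : ProperColoring rep col
  rep-proper u v (u≢v , uv) = AllPairs-lookup sym-proper proper {u} {v} u≢v (Meets⇒Overlap {seg u} {seg v} uv)
    where sym-proper : ∀ {a b} → Apart a b → Apart b a
          sym-proper {a} {b} ab≢ ba eq = ab≢ (Overlap-sym {b} {a} ba) (sym eq)

  rep-support : ∀ v i → 1 ℕ.≤ i → i ℕ.≤ col v → ∃ λ u → InClosedNbhd rep v u × col u ≡ i
  rep-support v i 1≤i i≤cv with i ℕ.≟ col v
  ... | yes refl = v , inj₁ refl , refl
  ... | no i≢cv = u , inj₂ (Overlap⇒Adj u≢v (Overlap-sym {seg v} {seg u} vu)) , cu≡i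
    where
    found = All.lookup supported (∈-lookup v) i 1≤i (ℕP.≤∧≢⇒< i≤cv i≢cv)
    u = Any.index found
    vu = proj₁ (AnyP.lookup-index found)
    cu≡i = proj₂ (AnyP.lookup-index found)
    u≢v : u ≢ v
    u≢v u≡v = i≢cv (trans (sym cu≡i) (cong col u≡v))

  toWall : Wall n
  toWall = record
    { rep      = rep
    ; col      = col
    ; positive = λ v → All.lookup positive (∈-lookup v)
    ; proper   = rep-proper
    ; support  = rep-support
    }

  uses⇒colours≥ : ∀ {T} → Uses T ss → T ℕ.≤ wallColors toWall
  uses⇒colours≥ {T} uses = begin
    T                        ≡⟨ trans (LP.length-map suc (upTo T)) (LP.length-upTo T) ⟨
    length (map suc (upTo T)) ≤⟨ unique-⊆⇒length≤ (UniqueP.map⁺ ℕP.suc-injective (UniqueP.upTo⁺ T)) used ⟩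
    wallColors toWall        ∎
    where
    open ℕP.≤-Reasoning
    used : ∀ {j} → j ∈ map suc (upTo T) → j ∈ deduplicate ℕ._≟_ (tabulate col)
    used j∈ with ∈-map⁻ suc j∈
    ... | i , i∈ , refl = ∈-deduplicate⁺ ℕ._≟_
      (subst (_∈ tabulate col) (AnyP.lookup-index found) (∈-tabulate⁺ (Any.index found)))
      where found = uses (suc i) (ℕ.s≤s ℕ.z≤n) (∈-upTo⁻ i∈)

  clique≤depth : ∀ {k} → (∀ x → depth x ss ℕ.≤ k) → ∀ S → IsClique rep S → length S ℕ.≤ k
  clique≤depth shallow [] _ = ℕ.z≤n
  clique≤depth {k} shallow S@(_ ∷ _) (S! , adj) with pairwise-overlapping⇒common-point seg left≤right
    where
    left≤right : ∀ {a b} → a ∈ S → b ∈ S → left (seg a) ≤ right (seg b)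
    left≤right {a} {b} a∈ b∈ with a FinP.≟ b
    ... | yes refl = seg-nonempty a
    ... | no a≢b = proj₁ (Meets⇒Overlap {seg a} {seg b} (proj₂ (All.lookup (All.lookup adj a∈) b∈ a≢b)))
  ... | x , covered = begin
    length S                                              ≤⟨ unique-⊆⇒length≤ S! (λ {u} u∈ →
                                                               ∈-filter⁺ (λ u → covers? x (seg u)) (∈-allFin u) (All.lookup covered u∈)) ⟩
    length (filter (λ u → covers? x (seg u)) (allFin n)) ≡⟨ depth-tabulate x seg ⟨
    depth x (tabulate seg)                                ≡⟨ cong (depth x) (LP.tabulate-lookup ss) ⟩
    depth x ss                                            ≤⟨ shallow x ⟩
    k                                                     ∎
    where open ℕP.≤-Reasoning

  overlapping⇒clique : ∀ {k} (f : Fin k → Segment) → Injective _≡_ _≡_ f → (∀ i → f i ∈ ss) →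
                       (∀ i j → Overlap (f i) (f j)) → ∃ λ S → IsClique rep S × length S ≡ k
  overlapping⇒clique f f-inj f∈ f-overlap =
    tabulate index , (UniqueP.tabulate⁺ index-inj , AllP.tabulate⁺ λ i → AllP.tabulate⁺ λ j i≢j →
      Overlap⇒Adj i≢j (subst₂ Overlap (sym (seg-index i)) (sym (seg-index j)) (f-overlap i j))) ,
    LP.length-tabulate index
    where
    index : _ → Fin n
    index i = Any.index (f∈ i)
    seg-index : ∀ i → seg (index i) ≡ f i
    seg-index i = sym (AnyP.lookup-index (f∈ i))
    index-inj : ∀ {i j} → index i ≡ index j → i ≡ j
    index-inj {i} {j} eq = f-inj (trans (sym (seg-index i)) (trans (cong seg eq) (seg-index j)))

Within : ℚ → ℚ → Segment → Set
Within lo hi s = lo ≤ left s × left s ≤ right s × right s ≤ hi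

InPalette : ℕ → Segment → Set
InPalette T s = 1 ℕ.≤ colour s × colour s ℕ.≤ T

stack : ℚ → ℕ → List Segment
stack p T = tabulate λ (j : Fin T) → segment p p (suc (toℕ j))

stack-length : ∀ p T → length (stack p T) ≡ T
stack-length p T = LP.length-tabulate _

stack-∋ : ∀ p {T} j → 1 ℕ.≤ j → j ℕ.≤ T → Any (_≡ segment p p j) (stack p T)
stack-∋ p (suc j) _ j<T = AnyP.tabulate⁺ (Fin.fromℕ< j<T) (cong (segment p p ∘ suc) (FinP.toℕ-fromℕ< j<T))

stack-uses : ∀ p T → Uses T (stack p T)
stack-uses p T j 1≤j j≤T = Any.map (λ { refl → refl }) (stack-∋ p j 1≤j j≤T)

stack-within : ∀ {lo hi p} T → lo ≤ p → p ≤ hi → All (Within lo hi) (stack p T)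
stack-within T lo≤p p≤hi = AllP.tabulate⁺ λ _ → lo≤p , ℚP.≤-refl , p≤hi

stack-palette : ∀ p T → All (InPalette T) (stack p T)
stack-palette p T = AllP.tabulate⁺ λ j → ℕ.s≤s ℕ.z≤n , FinP.toℕ<n j

stack-proper : ∀ p T → Proper (stack p T)
stack-proper p T = AllPairsP.tabulate⁺ λ i≢j _ same → i≢j (FinP.toℕ-injective (ℕP.suc-injective same))

stack-supported : ∀ p T → Supported (stack p T) (stack p T)
stack-supported p T = AllP.tabulate⁺ λ k j 1≤j j<k →
  Any.map (λ { refl → (ℚP.≤-refl , ℚP.≤-refl) , refl })
          (stack-∋ p j 1≤j (ℕP.≤-trans (ℕP.<⇒≤ j<k) (FinP.toℕ<n k)))

-- Ordering the vertices by colour, first-fit reproduces the colouring of a wall.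
module ColourOrder {n : ℕ} (W : Wall n) where
  open Wall W

  position : Fin n → ℕ
  position v = col v ℕ.* n ℕ.+ toℕ v

  position-mono : ∀ {u v} → col u ℕ.< col v → position u ℕ.< position v
  position-mono {u} {v} cu<cv = begin-strict
    col u ℕ.* n ℕ.+ toℕ u  <⟨ ℕP.+-monoʳ-< (col u ℕ.* n) (FinP.toℕ<n u) ⟩
    col u ℕ.* n ℕ.+ n      ≡⟨ ℕP.+-comm (col u ℕ.* n) n ⟩
    suc (col u) ℕ.* n      ≤⟨ ℕP.*-monoˡ-≤ n cu<cv ⟩
    col v ℕ.* n            ≤⟨ ℕP.m≤m+n (col v ℕ.* n) (toℕ v) ⟩
    position v             ∎
    where open ℕP.≤-Reasoning

  position-injective : Injective _≡_ _≡_ position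
  position-injective {u} {v} pu≡pv with ℕP.<-cmp (col u) (col v)
  ... | tri< cu<cv _ _ = ⊥-elim (ℕP.<⇒≢ (position-mono cu<cv) pu≡pv)
  ... | tri> _ _ cv<cu = ⊥-elim (ℕP.<⇒≢ (position-mono cv<cu) (sym pu≡pv))
  ... | tri≈ _ cu≡cv _ = FinP.toℕ-injective (ℕP.+-cancelˡ-≡ (col v ℕ.* n) _ _
                           (trans (cong (λ c → c ℕ.* n ℕ.+ toℕ u) (sym cu≡cv)) pu≡pv))

  firstFit : IsFirstFit rep position col
  firstFit v = positive v , (λ u adj _ → proper u v adj) , earlier
    where
    earlier : ∀ i → 1 ℕ.≤ i → i ℕ.< col v → ∃ λ u → Adj rep u v × position u ℕ.< position v × col u ≡ i
    earlier i 1≤i i<cv with support v i 1≤i (ℕP.<⇒≤ i<cv)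
    ... | u , inj₁ refl , cu≡i = ⊥-elim (ℕP.<⇒≢ i<cv (sym cu≡i))
    ... | u , inj₂ adj , cu≡i = u , adj , position-mono (subst (ℕ._< col v) (sym cu≡i) i<cv) , cu≡i

WallFamily : ℚ → ℚ → Set₁
WallFamily r b = ∀ (k : ℕ) → ∃ λ n → Σ (Wall n) λ W →
  CliqueNumber (Wall.rep W) k × (r * ℕ→ℚ k - b ≤ ℕ→ℚ (wallColors W))

-- For k > b / (r − q) the wall with clique number k beats q.
wallFamily⇒LeR : ∀ {r b} → WallFamily r b → LeR r
wallFamily⇒LeR {r} {b} walls q q<r =
  n , 1≤n , Wall.rep W , k , clique , position , position-injective , Wall.col W , firstFit , qk<colours
  where
  ε = r - q
  instance
    ε>0 : ℚ.Positive ε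
    ε>0 = ℚ.positive (p<q⇒0<q-p q<r)
    ε≢0 : ℚ.NonZero ε
    ε≢0 = ℚP.pos⇒nonZero ε
  B = proj₁ (archimedean (b * 1/ ε))
  k = suc B
  K = ℕ→ℚ k
  b<Kε : b < K * ε
  b<Kε = subst (_< K * ε) b/ε*ε≡b
    (ℚP.*-monoˡ-<-pos ε (ℚP.<-trans (proj₂ (archimedean (b * 1/ ε))) (ℕ→ℚ-mono-< {B} {k} ℕP.≤-refl)))
    where
    b/ε*ε≡b : b * 1/ ε * ε ≡ b
    b/ε*ε≡b = trans (ℚP.*-assoc b (1/ ε) ε) (trans (cong (b *_) (ℚP.*-inverseˡ ε)) (ℚP.*-identityʳ b))
  qK<rK-b : q * K < r * K - b
  qK<rK-b = begin-strict
    q * K               ≡⟨ solve 2 (λ x b → x := x :+ b :- b) refl (q * K) b ⟩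
    q * K + b - b       <⟨ ℚP.+-monoˡ-< (- b) (ℚP.+-monoʳ-< (q * K) b<Kε) ⟩
    q * K + K * ε - b   ≡⟨ solve 4 (λ q r K b → q :* K :+ K :* (r :- q) :- b := r :* K :- b) refl q r K b ⟩
    r * K - b           ∎
    where open ℚP.≤-Reasoning
          open +-*-Solver
  n = proj₁ (walls k)
  W = proj₁ (proj₂ (walls k))
  clique = proj₁ (proj₂ (proj₂ (walls k)))
  open ColourOrder W
  qk<colours : q * K < ℕ→ℚ (imageSize ℕ._≟_ (Wall.col W))
  qk<colours = ℚP.<-≤-trans qK<rK-b (proj₂ (proj₂ (proj₂ (walls k))))
  1≤n : 1 ℕ.≤ n
  1≤n with proj₁ clique
  ... | [] , _ , ()
  ... | (u ∷ _) , _ , _ = ℕP.≤-trans (ℕ.s≤s ℕ.z≤n) (FinP.toℕ<n u)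

-- Caps in closed normal form

nonpositive≡-∣∣ : ∀ {z} → z ℤ.≤ + 0 → z ≡ ℤ.- + ℤ.∣ z ∣
nonpositive≡-∣∣ {+ zero}   _ = refl
nonpositive≡-∣∣ { -[1+ m ]} _ = refl
nonpositive≡-∣∣ {+ suc m} (ℤ.+≤+ ())

negative⇒1≤∣∣ : ∀ {z} → z ℤ.< + 0 → 1 ℕ.≤ ℤ.∣ z ∣
negative⇒1≤∣∣ { -[1+ _ ]} _ = ℕ.s≤s ℕ.z≤n
negative⇒1≤∣∣ {+ _}      (ℤ.+<+ ())

neg-ℕ-antimono-≤ : ∀ {m n} → m ℕ.≤ n → ℤ.- + n ℤ.≤ ℤ.- + m
neg-ℕ-antimono-≤ m≤n = ℤP.neg-mono-≤ (ℤ.+≤+ m≤n)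

neg-ℕ-antimono-< : ∀ {m n} → m ℕ.< n → ℤ.- + n ℤ.< ℤ.- + m
neg-ℕ-antimono-< m<n = ℤP.neg-mono-< (ℤ.+<+ m<n)

neg-ℕ-injective : ∀ {m n} → ℤ.- + m ≡ ℤ.- + n → m ≡ n
neg-ℕ-injective eq = ℤP.+-injective (ℤP.neg-injective eq)

-- The interval of u is the closed segment [lo u, hi u], the window of v is [wlo v, whi v],
-- and colours are negated: d = −f, e = −c.
record ClosedCap (r : ℚ) : Set where
  field
    n : ℕ
    lo hi : Fin n → ℚ
    wlo whi : Fin n → ℚ
    d e : Fin n → ℕ
    1≤e : ∀ v → 1 ℕ.≤ e v
    v₀ : Fin n
    d[v₀]≡0 : d v₀ ≡ 0
    lo≤wlo : ∀ v → lo v ≤ wlo v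
    wlo<whi : ∀ v → wlo v < whi v
    whi≤hi : ∀ v → whi v ≤ hi v
    windows-disjoint : ∀ u v → u ≢ v → whi u < wlo v ⊎ whi v < wlo u
    proper : ∀ u v → u ≢ v → lo u ≤ hi v → lo v ≤ hi u → d u ≢ d v
    emptiness : ∀ u v → lo u ≤ whi v → wlo v ≤ hi u → d u ℕ.< e v
    sparseness : ∀ v (is : List ℕ) → Unique is →
      All (λ i → ∃ λ u → (lo u ≤ whi v × wlo v ≤ hi u) × d u ≡ i) is →
      r * ℕ→ℚ (length is) ≤ ℕ→ℚ (e v)
    support : ∀ v i → d v ℕ.≤ i → i ℕ.< e v → ∃ λ u → (lo u ≤ hi v × lo v ≤ hi u) × d u ≡ i

module Normalise {r : ℚ} (cap : Cap r) where
  open Cap cap using (n; J; J⊆I; Jpos; c; c<0; nonpos; hasZero; emptiness; sparseness)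
    renaming (rep to I; col to f; proper to f-proper; support to f-support)

  d e : Fin n → ℕ
  d u = ℤ.∣ f u ∣
  e v = ℤ.∣ c v ∣

  f≡-d : ∀ u → f u ≡ ℤ.- + d u
  f≡-d u = nonpositive≡-∣∣ (nonpos u)

  c≡-e : ∀ v → c v ≡ ℤ.- + e v
  c≡-e v = nonpositive≡-∣∣ (ℤP.<⇒≤ (c<0 v))

  ≡d⇒≡f : ∀ {u v} → d u ≡ d v → f u ≡ f v
  ≡d⇒≡f {u} {v} du≡dv = trans (f≡-d u) (trans (cong (λ k → ℤ.- + k) du≡dv) (sym (f≡-d v)))

  1≤e : ∀ v → 1 ℕ.≤ e v
  1≤e v = negative⇒1≤∣∣ (c<0 v)

  record Link : Set where
    constructor link
    field
      source target : Fin n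
      meeting       : Meets (I source) (I target)

  point : Link → ℚ
  point ℓ = proj₁ (Link.meeting ℓ)

  support-witness : ∀ v i → d v ℕ.< i → i ℕ.< e v → ∃ λ u → d u ≡ i × Meets (I u) (I v)
  support-witness v i dv<i i<ev = neighbour (f-support v (ℤ.- + i)
    (subst (ℤ._< ℤ.- + i) (sym (c≡-e v)) (neg-ℕ-antimono-< i<ev))
    (subst (ℤ.- + i ℤ.≤_) (sym (f≡-d v)) (neg-ℕ-antimono-≤ (ℕP.<⇒≤ dv<i))))
    where
    neighbour : (∃ λ u → InClosedNbhd I v u × f u ≡ ℤ.- + i) → ∃ λ u → d u ≡ i × Meets (I u) (I v)
    neighbour (u , inj₁ refl , fu≡-i)         = ⊥-elim (ℕP.<⇒≢ dv<i (neg-ℕ-injective (trans (sym (f≡-d u)) fu≡-i)))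
    neighbour (u , inj₂ (_ , meets) , fu≡-i) = u , neg-ℕ-injective (trans (sym (f≡-d u)) fu≡-i) , meets

  links-if : ∀ v {i} → i ℕ.< e v → Dec (d v ℕ.< i) → List Link
  links-if v i<ev (yes dv<i) = let (u , _ , meets) = support-witness v _ dv<i i<ev in [ link u v meets ]
  links-if v i<ev (no _)     = []

  links-at : ∀ v → Fin (e v) → List Link
  links-at v i = links-if v (FinP.toℕ<n i) (d v ℕ.<? toℕ i)

  links : List Link
  links = concat (tabulate λ v → concat (tabulate (links-at v)))

  SupportLink : Fin n → ℕ → Link → Set
  SupportLink v i ℓ = Link.target ℓ ≡ v × d (Link.source ℓ) ≡ i

  links-if-∋ : ∀ v {i} (i<ev : i ℕ.< e v) (dv<i? : Dec (d v ℕ.< i)) → d v ℕ.< i →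
               Any (SupportLink v i) (links-if v i<ev dv<i?)
  links-if-∋ v i<ev (yes dv<i) _ = here (refl , proj₁ (proj₂ (support-witness v _ dv<i i<ev)))
  links-if-∋ v i<ev (no dv≮i) dv<i = ⊥-elim (dv≮i dv<i)

  links-at-∋ : ∀ v i → d v ℕ.< toℕ i → Any (SupportLink v (toℕ i)) (links-at v i)
  links-at-∋ v i = links-if-∋ v (FinP.toℕ<n i) (d v ℕ.<? toℕ i)

  links-∋ : ∀ v i → d v ℕ.< i → i ℕ.< e v → Any (SupportLink v i) links
  links-∋ v i dv<i i<ev =
    AnyP.concat⁺ (AnyP.tabulate⁺ v (AnyP.concat⁺ (AnyP.tabulate⁺ i′
      (subst (λ k → Any (SupportLink v k) (links-at v i′)) i′≡i
        (links-at-∋ v i′ (subst (d v ℕ.<_) (sym i′≡i) dv<i))))))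
    where
    i′ = Fin.fromℕ< i<ev
    i′≡i = FinP.toℕ-fromℕ< i<ev

  Touches : Fin n → Link → Set
  Touches u ℓ = Link.source ℓ ≡ u ⊎ Link.target ℓ ≡ u

  Point : Fin n → Set
  Point u = Σ ℚ (mem (I u))

  points-if : ∀ {u s t p} → mem (I s) p → mem (I t) p → Dec (s ≡ u) → Dec (t ≡ u) → List (Point u)
  points-if p∈s p∈t (yes refl) _          = [ (_ , p∈s) ]
  points-if p∈s p∈t (no _)     (yes refl) = [ (_ , p∈t) ]
  points-if p∈s p∈t (no _)     (no _)     = []

  points-if-∋ : ∀ {u s t p} (p∈s : mem (I s) p) (p∈t : mem (I t) p) (s≡u? : Dec (s ≡ u)) (t≡u? : Dec (t ≡ u)) →
                s ≡ u ⊎ t ≡ u →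
                Any (λ q → proj₁ q ≡ p) (points-if p∈s p∈t s≡u? t≡u?)
  points-if-∋ p∈s p∈t (yes refl) _          _          = here refl
  points-if-∋ p∈s p∈t (no _)     (yes refl) _          = here refl
  points-if-∋ p∈s p∈t (no s≢u)   (no _)     (inj₁ s≡u) = ⊥-elim (s≢u s≡u)
  points-if-∋ p∈s p∈t (no _)     (no t≢u)   (inj₂ t≡u) = ⊥-elim (t≢u t≡u)

  points-of : ∀ u → Link → List (Point u)
  points-of u (link s t (p , p∈s , p∈t)) = points-if {u} p∈s p∈t (s FinP.≟ u) (t FinP.≟ u)

  points-of-∋ : ∀ u ℓ → Touches u ℓ → Any (λ q → proj₁ q ≡ point ℓ) (points-of u ℓ)
  points-of-∋ u (link s t (p , p∈s , p∈t)) = points-if-∋ {u} p∈s p∈t (s FinP.≟ u) (t FinP.≟ u)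

  points : ∀ u → List (Point u)
  points u = concatMap (points-of u) links

  points-∋ : ∀ {u ℓ} → ℓ ∈ links → Touches u ℓ → Any (λ q → proj₁ q ≡ point ℓ) (points u)
  points-∋ {u} {ℓ} ℓ∈ touches = AnyP.concat⁺ (AnyP.map⁺ (Any.map (λ { refl → points-of-∋ u ℓ touches }) ℓ∈))

  x y : Fin n → ℚ
  x v = proj₁ (Jpos v)
  y v = proj₁ (proj₂ (Jpos v))

  x<y : ∀ v → x v < y v
  x<y v = proj₁ (proj₂ (proj₂ (Jpos v)))

  x∈J : ∀ v → mem (J v) (x v)
  x∈J v = proj₁ (proj₂ (proj₂ (proj₂ (Jpos v))))

  y∈J : ∀ v → mem (J v) (y v)
  y∈J v = proj₂ (proj₂ (proj₂ (proj₂ (Jpos v))))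

  -- The hull [lo u, hi u] ⊆ I u is spanned by x u, y u ∈ J u and the points of the links at u.
  x-point y-point lowest highest : ∀ u → Point u
  x-point u = x u , J⊆I u (x u) (x∈J u)
  y-point u = y u , J⊆I u (y u) (y∈J u)
  lowest u  = Extrema.argmin proj₁ (x-point u) (points u)
  highest u = Extrema.argmax proj₁ (y-point u) (points u)

  lo hi : Fin n → ℚ
  lo u = proj₁ (lowest u)
  hi u = proj₁ (highest u)

  lo≤x : ∀ u → lo u ≤ x u
  lo≤x u = Extrema.f[argmin]≤f[⊤] {f = proj₁} (x-point u) (points u)

  y≤hi : ∀ u → y u ≤ hi u
  y≤hi u = Extrema.f[⊥]≤f[argmax] {f = proj₁} (y-point u) (points u)

  lo≤hi : ∀ u → lo u ≤ hi u
  lo≤hi u = ℚP.≤-trans (lo≤x u) (ℚP.≤-trans (ℚP.<⇒≤ (x<y u)) (y≤hi u))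

  lo≤point : ∀ {u ℓ} → ℓ ∈ links → Touches u ℓ → lo u ≤ point ℓ
  lo≤point {u} ℓ∈ touches = Extrema.f[argmin]≤v⁺ (x-point u) (points u)
    (inj₂ (Any.map ℚP.≤-reflexive (points-∋ ℓ∈ touches)))

  point≤hi : ∀ {u ℓ} → ℓ ∈ links → Touches u ℓ → point ℓ ≤ hi u
  point≤hi {u} ℓ∈ touches = Extrema.v≤f[argmax]⁺ (y-point u) (points u)
    (inj₂ (Any.map (λ eq → ℚP.≤-reflexive (sym eq)) (points-∋ ℓ∈ touches)))

  hull⊆I : ∀ u {z} → lo u ≤ z → z ≤ hi u → mem (I u) z
  hull⊆I u = convex (I u) (proj₂ (lowest u)) (proj₂ (highest u))

  differences : List ℚ
  differences = concat (tabulate λ u → (y u - x u) ∷ tabulate λ v → x v - x u)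

  -- δ is below every positive difference, so windows within δ to the right of distinct points are disjoint.
  δ : ℚ
  δ = Extrema.min 1ℚ (filter (0ℚ ℚP.<?_) differences)

  0<δ : 0ℚ < δ
  0<δ = Extrema.argmin-all (λ q → q) {P = 0ℚ <_} (ℚP.positive⁻¹ 1ℚ) (AllP.all-filter (0ℚ ℚP.<?_) differences)

  δ≤difference : ∀ {z} → z ∈ differences → 0ℚ < z → δ ≤ z
  δ≤difference z∈ 0<z = Extrema.min≤v⁺ 1ℚ (filter (0ℚ ℚP.<?_) differences)
    (inj₂ (lose (∈-filter⁺ (0ℚ ℚP.<?_) z∈ 0<z) ℚP.≤-refl))

  x+δ≤y : ∀ u → x u + δ ≤ y u
  x+δ≤y u = ≤q-p⇒p+≤q (δ≤difference (AnyP.concat⁺ (AnyP.tabulate⁺ u (here refl))) (p<q⇒0<q-p (x<y u)))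

  x+δ≤x : ∀ {u v} → x u < x v → x u + δ ≤ x v
  x+δ≤x {u} {v} xu<xv = ≤q-p⇒p+≤q
    (δ≤difference (AnyP.concat⁺ (AnyP.tabulate⁺ u (there (∈-tabulate⁺ v)))) (p<q⇒0<q-p xu<xv))

  -- Cut [x v, x v + δ] into 2n + 2 equal parts; the window of v is part 2v + 1, counting from 0.
  parts : ℕ
  parts = suc (suc (n ℕ.+ n))

  private
    instance
      parts>0 : ℚ.Positive (ℕ→ℚ parts)
      parts>0 = ℚ.positive (ℕ→ℚ-mono-< {0} {parts} (ℕ.s≤s ℕ.z≤n))
      parts≢0 : ℚ.NonZero (ℕ→ℚ parts)
      parts≢0 = ℚP.pos⇒nonZero (ℕ→ℚ parts)
      δ>0 : ℚ.Positive δ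
      δ>0 = ℚ.positive 0<δ

  η : ℚ
  η = δ * 1/ ℕ→ℚ parts

  private
    instance
      η>0 : ℚ.Positive η
      η>0 = ℚP.pos*pos⇒pos δ (1/ ℕ→ℚ parts) {{ℚP.1/pos⇒pos (ℕ→ℚ parts)}}

  step : ℕ → ℚ
  step k = ℕ→ℚ k * η

  step-mono-< : ∀ {a b} → a ℕ.< b → step a < step b
  step-mono-< {a} {b} a<b = ℚP.*-monoˡ-<-pos η (ℕ→ℚ-mono-< {a} {b} a<b)

  step-mono-≤ : ∀ {a b} → a ℕ.≤ b → step a ≤ step b
  step-mono-≤ {a} {b} a≤b = ℚP.*-monoʳ-≤-nonNeg η {{ℚP.pos⇒nonNeg η}} (ℕ→ℚ-mono-≤ {a} {b} a≤b)

  0<step : ∀ k → 0ℚ < step (suc k)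
  0<step k = subst (_< step (suc k)) (ℚP.*-zeroˡ η) (step-mono-< {0} {suc k} (ℕ.s≤s ℕ.z≤n))

  step-parts : step parts ≡ δ
  step-parts = begin
    ℕ→ℚ parts * (δ * 1/ ℕ→ℚ parts)   ≡⟨ ℚP.*-comm (ℕ→ℚ parts) _ ⟩
    δ * 1/ ℕ→ℚ parts * ℕ→ℚ parts     ≡⟨ ℚP.*-assoc δ _ _ ⟩
    δ * (1/ ℕ→ℚ parts * ℕ→ℚ parts)   ≡⟨ cong (δ *_) (ℚP.*-inverseˡ (ℕ→ℚ parts)) ⟩
    δ * 1ℚ                           ≡⟨ ℚP.*-identityʳ δ ⟩
    δ                                ∎
    where open ≡-Reasoning

  first last : Fin n → ℕ
  first v = suc (toℕ v ℕ.+ toℕ v)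
  last v  = suc (first v)

  last<first : ∀ {u v} → toℕ u ℕ.< toℕ v → last u ℕ.< first v
  last<first {u} {v} u<v = ℕ.s≤s (subst (ℕ._≤ toℕ v ℕ.+ toℕ v) (ℕP.+-suc (suc (toℕ u)) (toℕ u)) (ℕP.+-mono-≤ u<v u<v))

  last≤parts : ∀ v → last v ℕ.≤ parts
  last≤parts v = ℕ.s≤s (ℕ.s≤s (ℕP.+-mono-≤ (ℕP.<⇒≤ (FinP.toℕ<n v)) (ℕP.<⇒≤ (FinP.toℕ<n v))))

  wlo whi : Fin n → ℚ
  wlo v = x v + step (first v)
  whi v = x v + step (last v)

  x<wlo : ∀ v → x v < wlo v
  x<wlo v = p<p+q (x v) (0<step (toℕ v ℕ.+ toℕ v))

  wlo<whi : ∀ v → wlo v < whi v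
  wlo<whi v = ℚP.+-monoʳ-< (x v) (step-mono-< {first v} {last v} ℕP.≤-refl)

  whi≤x+δ : ∀ v → whi v ≤ x v + δ
  whi≤x+δ v = ℚP.+-monoʳ-≤ (x v) (subst (step (last v) ≤_) step-parts (step-mono-≤ {last v} {parts} (last≤parts v)))

  whi≤y : ∀ v → whi v ≤ y v
  whi≤y v = ℚP.≤-trans (whi≤x+δ v) (x+δ≤y v)

  window-before : ∀ {u v} → x u < x v ⊎ (x u ≡ x v × toℕ u ℕ.< toℕ v) → whi u < wlo v
  window-before {u} {v} (inj₁ xu<xv) = ℚP.≤-<-trans (ℚP.≤-trans (whi≤x+δ u) (x+δ≤x xu<xv)) (x<wlo v)
  window-before {u} {v} (inj₂ (xu≡xv , u<v)) = subst (λ z → whi u < z + step (first v)) xu≡xv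
    (ℚP.+-monoʳ-< (x u) (step-mono-< {last u} {first v} (last<first u<v)))

  windows-disjoint : ∀ u v → u ≢ v → whi u < wlo v ⊎ whi v < wlo u
  windows-disjoint u v u≢v = by-point (ℚP.<-cmp (x u) (x v))
    where
    by-index : x u ≡ x v → Tri (toℕ u ℕ.< toℕ v) (toℕ u ≡ toℕ v) (toℕ v ℕ.< toℕ u) → whi u < wlo v ⊎ whi v < wlo u
    by-index xu≡xv (tri< u<v _ _) = inj₁ (window-before (inj₂ (xu≡xv , u<v)))
    by-index xu≡xv (tri≈ _ u≡v _) = ⊥-elim (u≢v (FinP.toℕ-injective u≡v))
    by-index xu≡xv (tri> _ _ v<u) = inj₂ (window-before (inj₂ (sym xu≡xv , v<u)))
    by-point : Tri (x u < x v) (x u ≡ x v) (x v < x u) → whi u < wlo v ⊎ whi v < wlo u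
    by-point (tri< xu<xv _ _) = inj₁ (window-before (inj₁ xu<xv))
    by-point (tri≈ _ xu≡xv _) = by-index xu≡xv (ℕP.<-cmp (toℕ u) (toℕ v))
    by-point (tri> _ _ xv<xu) = inj₂ (window-before (inj₁ xv<xu))

  window⊆J : ∀ v {z} → wlo v ≤ z → z ≤ whi v → mem (J v) z
  window⊆J v wlo≤z z≤whi = convex (J v) (x∈J v) (y∈J v)
    (ℚP.≤-trans (ℚP.<⇒≤ (x<wlo v)) wlo≤z) (ℚP.≤-trans z≤whi (whi≤y v))

  hulls-meet : ∀ u v → lo u ≤ hi v → lo v ≤ hi u → Meets (I u) (I v)
  hulls-meet u v = segments-meet (I u) (I v) (hull⊆I u) (hull⊆I v) (lo≤hi u) (lo≤hi v)

  hull-meets-window : ∀ u v → lo u ≤ whi v → wlo v ≤ hi u → Meets (I u) (J v)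
  hull-meets-window u v = segments-meet (I u) (J v) (hull⊆I u) (window⊆J v) (lo≤hi u) (ℚP.<⇒≤ (wlo<whi v))

  closed-proper : ∀ u v → u ≢ v → lo u ≤ hi v → lo v ≤ hi u → d u ≢ d v
  closed-proper u v u≢v u≤v v≤u du≡dv = f-proper u v (u≢v , hulls-meet u v u≤v v≤u) (≡d⇒≡f du≡dv)

  closed-emptiness : ∀ u v → lo u ≤ whi v → wlo v ≤ hi u → d u ℕ.< e v
  closed-emptiness u v u≤v v≤u = ℕP.≰⇒> λ ev≤du → emptiness v u (hull-meets-window u v u≤v v≤u)
    (subst₂ ℤ._≤_ (sym (f≡-d u)) (sym (c≡-e v)) (neg-ℕ-antimono-≤ ev≤du))

  closed-sparseness : ∀ v (is : List ℕ) → Unique is →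
    All (λ i → ∃ λ u → (lo u ≤ whi v × wlo v ≤ hi u) × d u ≡ i) is →
    r * ℕ→ℚ (length is) ≤ ℕ→ℚ (e v)
  closed-sparseness v is is! seen = subst (λ k → r * ℕ→ℚ k ≤ ℕ→ℚ (e v)) (LP.length-map negate is)
    (subst (λ z → r * ℕ→ℚ (length (map negate is)) ≤ ℤ→ℚ z) -c≡e
      (sparseness v (map negate is) (UniqueP.map⁺ neg-ℕ-injective is!) (AllP.map⁺ (All.map visible seen))))
    where
    negate : ℕ → ℤ
    negate i = ℤ.- + i
    -c≡e : ℤ.- c v ≡ + e v
    -c≡e = trans (cong ℤ.-_ (c≡-e v)) (ℤP.neg-involutive (+ e v))
    visible : ∀ {i} → (∃ λ u → (lo u ≤ whi v × wlo v ≤ hi u) × d u ≡ i) →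
      (∃ λ u → Meets (I u) (J v) × f u ≡ negate i) × c v ℤ.< negate i × negate i ℤ.≤ + 0
    visible (u , (u≤v , v≤u) , refl) =
      (u , hull-meets-window u v u≤v v≤u , f≡-d u) ,
      subst (ℤ._< negate (d u)) (sym (c≡-e v)) (neg-ℕ-antimono-< (closed-emptiness u v u≤v v≤u)) ,
      neg-ℕ-antimono-≤ ℕ.z≤n

  closed-support : ∀ v i → d v ℕ.≤ i → i ℕ.< e v → ∃ λ u → (lo u ≤ hi v × lo v ≤ hi u) × d u ≡ i
  closed-support v i dv≤i i<ev = by-cases (ℕP.m≤n⇒m<n∨m≡n dv≤i)
    where
    via-link : (∃ λ ℓ → ℓ ∈ links × SupportLink v i ℓ) → ∃ λ u → (lo u ≤ hi v × lo v ≤ hi u) × d u ≡ i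
    via-link (ℓ , ℓ∈ , refl , du≡i) = Link.source ℓ ,
      (ℚP.≤-trans (lo≤point ℓ∈ (inj₁ refl)) (point≤hi ℓ∈ (inj₂ refl)) ,
       ℚP.≤-trans (lo≤point ℓ∈ (inj₂ refl)) (point≤hi ℓ∈ (inj₁ refl))) ,
      du≡i
    by-cases : d v ℕ.< i ⊎ d v ≡ i → ∃ λ u → (lo u ≤ hi v × lo v ≤ hi u) × d u ≡ i
    by-cases (inj₁ dv<i) = via-link (find (links-∋ v i dv<i i<ev))
    by-cases (inj₂ dv≡i) = v , (lo≤hi v , lo≤hi v) , dv≡i

  closedCap : ClosedCap r
  closedCap = record
    { n                = Cap.n cap
    ; lo               = lo
    ; hi               = hi
    ; wlo              = wlo
    ; whi              = whi
    ; d                = d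
    ; e                = e
    ; 1≤e              = 1≤e
    ; v₀               = proj₁ hasZero
    ; d[v₀]≡0          = cong ℤ.∣_∣ (proj₂ hasZero)
    ; lo≤wlo           = λ v → ℚP.≤-trans (lo≤x v) (ℚP.<⇒≤ (x<wlo v))
    ; wlo<whi          = wlo<whi
    ; whi≤hi           = λ v → ℚP.≤-trans (whi≤y v) (y≤hi v)
    ; windows-disjoint = windows-disjoint
    ; proper           = closed-proper
    ; emptiness        = closed-emptiness
    ; sparseness       = closed-sparseness
    ; support          = closed-support
    }

-- The layered walls

module Construction {r : ℚ} (0<r : 0ℚ < r) (cap : ClosedCap r) where
  open ClosedCap cap

  private
    instance
      r>0 : ℚ.Positive r
      r>0 = ℚ.positive 0<r

  r*-mono : ∀ {a b} → a ℕ.≤ b → r * ℕ→ℚ a ≤ r * ℕ→ℚ b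
  r*-mono {a} {b} a≤b = ℚP.*-monoˡ-≤-nonNeg r {{ℚP.pos⇒nonNeg r}} (ℕ→ℚ-mono-≤ {a} {b} a≤b)

  Lo Hi : ℚ
  Lo = Extrema.min 0ℚ (tabulate lo)
  Hi = Extrema.max 0ℚ (tabulate hi)

  Lo≤lo : ∀ v → Lo ≤ lo v
  Lo≤lo v = Extrema.min≤v⁺ 0ℚ (tabulate lo) (inj₂ (AnyP.tabulate⁺ v ℚP.≤-refl))

  hi≤Hi : ∀ v → hi v ≤ Hi
  hi≤Hi v = Extrema.v≤max⁺ 0ℚ (tabulate hi) (inj₂ (AnyP.tabulate⁺ v ℚP.≤-refl))

  lo≤hi : ∀ v → lo v ≤ hi v
  lo≤hi v = ℚP.≤-trans (lo≤wlo v) (ℚP.≤-trans (ℚP.<⇒≤ (wlo<whi v)) (whi≤hi v))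

  Lo<Hi : Lo < Hi
  Lo<Hi = ℚP.≤-<-trans (ℚP.≤-trans (Lo≤lo v₀) (lo≤wlo v₀))
                       (ℚP.<-≤-trans (wlo<whi v₀) (ℚP.≤-trans (whi≤hi v₀) (hi≤Hi v₀)))

  M : ℕ
  M = ℕExtrema.max 0 (tabulate e)

  e≤M : ∀ v → e v ℕ.≤ M
  e≤M v = ℕExtrema.v≤max⁺ 0 (tabulate e) (inj₂ (AnyP.tabulate⁺ v ℕP.≤-refl))

  d<e : ∀ v → d v ℕ.< e v
  d<e v = emptiness v v (ℚP.≤-trans (lo≤wlo v) (ℚP.<⇒≤ (wlo<whi v))) (ℚP.≤-trans (ℚP.<⇒≤ (wlo<whi v)) (whi≤hi v))

  -- β pays for the stacks with fewer than M colours and for the at most n caps over a point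
  -- outside all windows.
  β : ℚ
  β = r * ℕ→ℚ (n ℕ.+ M)

  β≤T+β : ∀ T → β ≤ ℕ→ℚ T + β
  β≤T+β T = subst (_≤ ℕ→ℚ T + β) (ℚP.+-identityˡ β) (ℚP.+-monoˡ-≤ β (0≤ℕ→ℚ T))

  record ThinWall (T : ℕ) : Set where
    field
      segments  : List Segment
      framed    : All (Within Lo Hi) segments
      palette   : All (InPalette T) segments
      uses      : Uses T segments
      apart     : Proper segments
      supported : Supported segments segments
      thin      : ∀ x → r * ℕ→ℚ (depth x segments) ≤ ℕ→ℚ T + β
  open ThinWall

  stackWall : ∀ T → T ℕ.≤ n ℕ.+ M → ThinWall T
  stackWall T T≤n+M = record
    { segments  = stack Lo T
    ; framed    = stack-within T ℚP.≤-refl (ℚP.<⇒≤ Lo<Hi)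
    ; palette   = stack-palette Lo T
    ; uses      = stack-uses Lo T
    ; apart     = stack-proper Lo T
    ; supported = stack-supported Lo T
    ; thin      = λ x → ℚP.≤-trans (r*-mono (ℕP.≤-trans (depth≤length x (stack Lo T))
                    (subst (ℕ._≤ n ℕ.+ M) (sym (stack-length Lo T)) T≤n+M))) (β≤T+β T)
    }

  module Layering (T : ℕ) (M≤T : M ℕ.≤ T) (inner : (v : Fin n) → ThinWall (T ∸ e v)) where

    module Window v = Affine {Lo} {Hi} {wlo v} {whi v} Lo<Hi (wlo<whi v)

    e≤T : ∀ v → e v ℕ.≤ T
    e≤T v = ℕP.≤-trans (e≤M v) M≤T

    d≤T : ∀ v → d v ℕ.≤ T
    d≤T v = ℕP.≤-trans (ℕP.<⇒≤ (d<e v)) (e≤T v)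

    capSegment : Fin n → Segment
    capSegment u = segment (lo u) (hi u) (T ∸ d u)

    block : Fin n → List Segment
    block v = map (Window.rescale v) (segments (inner v))

    caps blocks layered : List Segment
    caps    = tabulate capSegment
    blocks  = concat (tabulate block)
    layered = caps ++ blocks

    InBlock : Fin n → Segment → Set
    InBlock v s = Within (wlo v) (whi v) s × InPalette (T ∸ e v) s

    block-bounds : ∀ v → All (InBlock v) (block v)
    block-bounds v = AllP.map⁺ (All.zipWith rescaled (framed (inner v) , palette (inner v)))
      where
      open Window v
      rescaled : ∀ {s} → Within Lo Hi s × InPalette (T ∸ e v) s → InBlock v (rescale s)
      rescaled {s} ((Lo≤l , l≤r , r≤Hi) , inPalette) =
        (subst (_≤ φ (left s)) φ-lo (φ-mono-≤ Lo≤l) , φ-mono-≤ l≤r , subst (φ (right s) ≤_) φ-hi (φ-mono-≤ r≤Hi)) ,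
        inPalette

    all-blocks : ∀ {P : Segment → Set} → (∀ v → All P (block v)) → All P blocks
    all-blocks P-block = AllP.concat⁺ (AllP.tabulate⁺ P-block)

    from-block : ∀ {P : Segment → Set} v → Any P (block v) → Any P layered
    from-block v p = AnyP.++⁺ʳ caps (AnyP.concat⁺ (AnyP.tabulate⁺ v p))

    from-cap : ∀ {P : Segment → Set} u → P (capSegment u) → Any P layered
    from-cap u p = AnyP.++⁺ˡ (AnyP.tabulate⁺ u p)

    colour-T∸ : ∀ {i j} → j ℕ.≤ T → i ≡ T ∸ j → T ∸ i ≡ j
    colour-T∸ j≤T refl = ℕP.m∸[m∸n]≡n j≤T

    layered-framed : All (Within Lo Hi) layered
    layered-framed = AllP.++⁺ (AllP.tabulate⁺ λ u → Lo≤lo u , lo≤hi u , hi≤Hi u)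
      (all-blocks λ v → All.map (λ ((wlo≤l , l≤r , r≤whi) , _) →
        ℚP.≤-trans (Lo≤lo v) (ℚP.≤-trans (lo≤wlo v) wlo≤l) , l≤r ,
        ℚP.≤-trans r≤whi (ℚP.≤-trans (whi≤hi v) (hi≤Hi v))) (block-bounds v))

    layered-palette : All (InPalette T) layered
    layered-palette = AllP.++⁺
      (AllP.tabulate⁺ λ u → ℕP.m<n⇒0<n∸m (ℕP.<-≤-trans (d<e u) (e≤T u)) , ℕP.m∸n≤m T (d u))
      (all-blocks λ v → All.map (λ (_ , (1≤c , c≤T∸e)) → 1≤c , ℕP.≤-trans c≤T∸e (ℕP.m∸n≤m T (e v))) (block-bounds v))

    -- Colours up to T − e v₀ come from the block of v₀; the cap, where f(v₀) = 0, supplies the rest.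
    layered-uses : Uses T layered
    layered-uses j 1≤j j≤T = by-size (j ℕ.≤? T ∸ e v₀)
      where
      by-size : Dec (j ℕ.≤ T ∸ e v₀) → Any (λ s → colour s ≡ j) layered
      by-size (yes j≤T∸e) = from-block v₀ (AnyP.map⁺ (uses (inner v₀) j 1≤j j≤T∸e))
      by-size (no j≰T∸e)  =
        let (u , _ , du≡T∸j) = support v₀ (T ∸ j) (subst (ℕ._≤ T ∸ j) (sym d[v₀]≡0) ℕ.z≤n)
                                          (m∸o<n⇒m∸n<o j≤T (ℕP.≰⇒> j≰T∸e))
        in from-cap u (colour-T∸ j≤T du≡T∸j)

    caps-proper : Proper caps
    caps-proper = AllPairsP.tabulate⁺ λ {u} {v} u≢v (u≤v , v≤u) same →
      proper u v u≢v u≤v v≤u (ℕP.∸-cancelˡ-≡ (d≤T u) (d≤T v) same)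

    windows-apart : ∀ {u v a b} → u ≢ v → InBlock u a → InBlock v b → ¬ Overlap a b
    windows-apart {u} {v} u≢v ((wlo≤la , _ , ra≤whi) , _) ((wlo≤lb , _ , rb≤whi) , _) (la≤rb , lb≤ra) =
      either (λ whi<wlo → <⇒≱ whi<wlo (ℚP.≤-trans wlo≤lb (ℚP.≤-trans lb≤ra ra≤whi)))
             (λ whi<wlo → <⇒≱ whi<wlo (ℚP.≤-trans wlo≤la (ℚP.≤-trans la≤rb rb≤whi))) (windows-disjoint u v u≢v)

    blocks-proper : Proper blocks
    blocks-proper = AllPairsP.concat⁺
      (AllP.tabulate⁺ λ v → AllPairsP.map⁺
        (AllPairs.map (λ {a} {b} ab-apart ov → ab-apart (Window.Overlap-rescale⁻ v {a} {b} ov)) (apart (inner v))))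
      (AllPairsP.tabulate⁺ λ {u} {v} u≢v → All.map (λ inU → All.map (λ inV ov _ → windows-apart u≢v inU inV ov)
        (block-bounds v)) (block-bounds u))

    -- A cap meeting the window of v has f > c_v, so its colour exceeds every colour of the block of v.
    cap-block-apart : ∀ {u v b} → InBlock v b → Apart (capSegment u) b
    cap-block-apart {u} {v} ((wlo≤l , _ , r≤whi) , (_ , c≤T∸e)) (lo≤r , l≤hi) same =
      ℕP.<-irrefl (sym same) (ℕP.≤-<-trans c≤T∸e
        (ℕP.∸-monoʳ-< (emptiness u v (ℚP.≤-trans lo≤r r≤whi) (ℚP.≤-trans wlo≤l l≤hi)) (e≤T v)))

    layered-proper : Proper layered
    layered-proper = AllPairsP.++⁺ caps-proper blocks-proper
      (AllP.tabulate⁺ λ u → all-blocks λ v → All.map cap-block-apart (block-bounds v))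

    cap-overlaps-block : ∀ {u b} → InBlock u b → Overlap (capSegment u) b
    cap-overlaps-block {u} ((wlo≤l , l≤r , r≤whi) , _) =
      ℚP.≤-trans (lo≤wlo u) (ℚP.≤-trans wlo≤l l≤r) , ℚP.≤-trans l≤r (ℚP.≤-trans r≤whi (whi≤hi u))

    -- Below T − e u the cap of u is supported by its own block, above it by the cap's support.
    cap-supported : ∀ u j → 1 ℕ.≤ j → j ℕ.< T ∸ d u → Any (λ b → Overlap (capSegment u) b × colour b ≡ j) layered
    cap-supported u j 1≤j j<T∸du = by-size (j ℕ.≤? T ∸ e u)
      where
      j≤T = ℕP.≤-trans (ℕP.<⇒≤ j<T∸du) (ℕP.m∸n≤m T (d u))
      by-size : Dec (j ℕ.≤ T ∸ e u) → Any (λ b → Overlap (capSegment u) b × colour b ≡ j) layered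
      by-size (yes j≤T∸e) =
        let (b , b∈ , cb≡j) = find (AnyP.map⁺ {P = λ b → colour b ≡ j} (uses (inner u) j 1≤j j≤T∸e))
        in from-block u (lose b∈ (cap-overlaps-block (All.lookup (block-bounds u) b∈) , cb≡j))
      by-size (no j≰T∸e) =
        let (u′ , (u′≤u , u≤u′) , du′≡T∸j) =
              support u (T ∸ j) (ℕP.<⇒≤ (n<m∸o⇒o<m∸n j≤T j<T∸du)) (m∸o<n⇒m∸n<o j≤T (ℕP.≰⇒> j≰T∸e))
        in from-cap u′ ((u≤u′ , u′≤u) , colour-T∸ j≤T du′≡T∸j)

    block-supported : ∀ v → Supported (block v) layered
    block-supported v = AllP.map⁺ (All.map (λ {b} b-supported j 1≤j j<c → from-block v (AnyP.map⁺
      (Any.map (λ {b′} (bb′ , c≡j) → Window.Overlap-rescale⁺ v {b} {b′} bb′ , c≡j) (b-supported j 1≤j j<c))))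
      (supported (inner v)))

    layered-supported : Supported layered layered
    layered-supported = AllP.++⁺ (AllP.tabulate⁺ cap-supported) (all-blocks block-supported)

    InWindow : ℚ → Fin n → Set
    InWindow x v = wlo v ≤ x × x ≤ whi v

    block-uncovered : ∀ {x u} → ¬ InWindow x u → All (λ s → ¬ Covers s x) (block u)
    block-uncovered {x} {u} x∉u = All.map (λ ((wlo≤l , _ , r≤whi) , _) (l≤x , x≤r) →
      x∉u (ℚP.≤-trans wlo≤l l≤x , ℚP.≤-trans x≤r r≤whi)) (block-bounds u)

    windows-exclusive : ∀ {x u v} → u ≢ v → InWindow x u → ¬ InWindow x v
    windows-exclusive {x} {u} {v} u≢v (wlo≤x , x≤whi) (wlo′≤x , x≤whi′) =
      either (λ whi<wlo → <⇒≱ whi<wlo (ℚP.≤-trans wlo′≤x x≤whi))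
             (λ whi<wlo → <⇒≱ whi<wlo (ℚP.≤-trans wlo≤x x≤whi′)) (windows-disjoint u v u≢v)

    -- The caps covering x have distinct colours and all meet the window of v, so sparseness applies.
    caps-sparse : ∀ {x v} → InWindow x v → r * ℕ→ℚ (depth x caps) ≤ ℕ→ℚ (e v)
    caps-sparse {x} {v} (wlo≤x , x≤whi) =
      subst (λ k → r * ℕ→ℚ k ≤ ℕ→ℚ (e v)) (trans (LP.length-map d S) (sym (depth-tabulate x capSegment)))
        (sparseness v (map d S) unique seen)
      where
      S = filter (λ u → covers? x (capSegment u)) (allFin n)
      S-covers : All (λ u → Covers (capSegment u) x) S
      S-covers = AllP.all-filter (λ u → covers? x (capSegment u)) (allFin n)
      unique : Unique (map d S)
      unique = AllPairsP.map⁺ (AllPairs-map-All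
        (λ {u} {u′} (lo≤x , x≤hi) (lo′≤x , x≤hi′) u≢u′ →
           proper u u′ u≢u′ (ℚP.≤-trans lo≤x x≤hi′) (ℚP.≤-trans lo′≤x x≤hi))
        S-covers (UniqueP.filter⁺ (λ u → covers? x (capSegment u)) (UniqueP.allFin⁺ n)))
      seen : All (λ i → ∃ λ u → (lo u ≤ whi v × wlo v ≤ hi u) × d u ≡ i) (map d S)
      seen = AllP.map⁺ (All.map (λ {u} (lo≤x , x≤hi) → u , (ℚP.≤-trans lo≤x x≤whi , ℚP.≤-trans wlo≤x x≤hi) , refl) S-covers)

    blocks-thin : ∀ {x v} → InWindow x v → r * ℕ→ℚ (depth x blocks) ≤ ℕ→ℚ (T ∸ e v) + β
    blocks-thin {x} {v} x∈v = subst (λ k → r * ℕ→ℚ k ≤ ℕ→ℚ (T ∸ e v) + β) (sym depth≡) (thin (inner v) (Window.ψ v x))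
      where
      depth≡ : depth x blocks ≡ depth (Window.ψ v x) (segments (inner v))
      depth≡ = trans (depth-concat-single block v λ u u≢v → block-uncovered λ x∈u → windows-exclusive u≢v x∈u x∈v)
                     (Window.depth-rescale v x (segments (inner v)))

    layered-thin-inside : ∀ {x v} → InWindow x v → r * ℕ→ℚ (depth x layered) ≤ ℕ→ℚ T + β
    layered-thin-inside {x} {v} x∈v = begin
      r * ℕ→ℚ (depth x layered)                           ≡⟨ cong (λ k → r * ℕ→ℚ k) (depth-++ x caps blocks) ⟩
      r * ℕ→ℚ (depth x caps ℕ.+ depth x blocks)           ≡⟨ cong (r *_) (ℕ→ℚ-homo-+ (depth x caps) (depth x blocks)) ⟩
      r * (ℕ→ℚ (depth x caps) + ℕ→ℚ (depth x blocks))     ≡⟨ ℚP.*-distribˡ-+ r (ℕ→ℚ (depth x caps)) (ℕ→ℚ (depth x blocks)) ⟩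
      r * ℕ→ℚ (depth x caps) + r * ℕ→ℚ (depth x blocks)   ≤⟨ ℚP.+-mono-≤ (caps-sparse x∈v) (blocks-thin x∈v) ⟩
      ℕ→ℚ (e v) + (ℕ→ℚ (T ∸ e v) + β)                     ≡⟨ ℚP.+-assoc (ℕ→ℚ (e v)) (ℕ→ℚ (T ∸ e v)) β ⟨
      ℕ→ℚ (e v) + ℕ→ℚ (T ∸ e v) + β                       ≡⟨ cong (_+ β) (ℕ→ℚ-homo-+ (e v) (T ∸ e v)) ⟨
      ℕ→ℚ (e v ℕ.+ (T ∸ e v)) + β                         ≡⟨ cong (λ k → ℕ→ℚ k + β) (ℕP.m+[n∸m]≡n (e≤T v)) ⟩
      ℕ→ℚ T + β                                           ∎
      where open ℚP.≤-Reasoning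

    layered-thin-outside : ∀ {x} → (∀ v → ¬ InWindow x v) → r * ℕ→ℚ (depth x layered) ≤ ℕ→ℚ T + β
    layered-thin-outside {x} x∉windows = ℚP.≤-trans (r*-mono (begin
      depth x layered                  ≡⟨ depth-++ x caps blocks ⟩
      depth x caps ℕ.+ depth x blocks  ≡⟨ cong (depth x caps ℕ.+_) (depth-uncovered (all-blocks λ u → block-uncovered (x∉windows u))) ⟩
      depth x caps ℕ.+ 0               ≤⟨ ℕP.+-monoˡ-≤ 0 (depth≤length x caps) ⟩
      length caps ℕ.+ 0                ≡⟨ cong (ℕ._+ 0) (LP.length-tabulate capSegment) ⟩
      n ℕ.+ 0                          ≤⟨ ℕP.+-monoʳ-≤ n ℕ.z≤n ⟩
      n ℕ.+ M                          ∎)) (β≤T+β T)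
      where open ℕP.≤-Reasoning

    window? : ∀ x v → Dec (InWindow x v)
    window? x v = (wlo v ℚP.≤? x) ×-dec (x ℚP.≤? whi v)

    layered-thin : ∀ x → r * ℕ→ℚ (depth x layered) ≤ ℕ→ℚ T + β
    layered-thin x = by-window (FinP.any? (window? x))
      where
      by-window : Dec (∃ (InWindow x)) → r * ℕ→ℚ (depth x layered) ≤ ℕ→ℚ T + β
      by-window (yes (v , x∈v)) = layered-thin-inside x∈v
      by-window (no x∉windows)  = layered-thin-outside λ v x∈v → x∉windows (v , x∈v)

    layeredWall : ThinWall T
    layeredWall = record
      { segments  = layered
      ; framed    = layered-framed
      ; palette   = layered-palette
      ; uses      = layered-uses
      ; apart     = layered-proper
      ; supported = layered-supported
      ; thin      = layered-thin
      }

  thinWall : ∀ T → ThinWall T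
  thinWall = <-rec ThinWall build
    where
    build : ∀ T → (∀ {T′} → T′ ℕ.< T → ThinWall T′) → ThinWall T
    build T smaller = by-size (M ℕ.≤? T)
      where
      by-size : Dec (M ℕ.≤ T) → ThinWall T
      by-size (yes M≤T) = Layering.layeredWall T M≤T λ v →
                            smaller (ℕP.∸-monoʳ-< {o = 0} (1≤e v) (ℕP.≤-trans (e≤M v) M≤T))
      by-size (no M≰T)  = stackWall T (ℕP.≤-trans (ℕP.<⇒≤ (ℕP.≰⇒> M≰T)) (ℕP.m≤n+m M n))

  colourless-empty : ∀ (W : ThinWall 0) x → depth x (segments W) ≡ 0
  colourless-empty W x = depth-uncovered (All.map (λ (1≤c , c≤0) _ → contradiction (ℕP.≤-trans 1≤c c≤0)) (palette W))
    where contradiction : 1 ℕ.≤ 0 → _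
          contradiction ()

  peak : ℚ
  peak = Hi + 1ℚ

  Hi<peak : Hi < peak
  Hi<peak = p<p+q Hi (ℚP.positive⁻¹ 1ℚ)

  -- The stack right of the frame forces clique number k; thinness keeps the wall from exceeding it.
  withClique : ℕ → ℕ → List Segment
  withClique k T = stack peak k ++ segments (thinWall T)

  withClique-isWall : ∀ k T → IsSegmentWall (withClique k T)
  withClique-isWall k T = record
    { nonempty  = AllP.++⁺ (All.map (λ (_ , l≤r , _) → l≤r) (stack-within k ℚP.≤-refl ℚP.≤-refl))
                           (All.map (λ (_ , l≤r , _) → l≤r) (framed W))
    ; positive  = AllP.++⁺ (All.map proj₁ (stack-palette peak k)) (All.map proj₁ (palette W))
    ; proper    = AllPairsP.++⁺ (stack-proper peak k) (apart W)
                    (AllP.tabulate⁺ λ _ → All.map (λ (_ , _ , r≤Hi) (peak≤r , _) _ →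
                       <⇒≱ Hi<peak (ℚP.≤-trans peak≤r r≤Hi)) (framed W))
    ; supported = AllP.++⁺ (All.map (λ sup j 1≤j j<c → AnyP.++⁺ˡ (sup j 1≤j j<c)) (stack-supported peak k))
                           (All.map (λ sup j 1≤j j<c → AnyP.++⁺ʳ (stack peak k) (sup j 1≤j j<c)) (supported W))
    }
    where W = thinWall T

  withClique-depth : ∀ k T → (∀ x → depth x (segments (thinWall T)) ℕ.≤ k) → ∀ x → depth x (withClique k T) ℕ.≤ k
  withClique-depth k T shallow x = by-side (Hi ℚP.<? x)
    where
    W = thinWall T
    by-side : Dec (Hi < x) → depth x (withClique k T) ℕ.≤ k
    by-side (yes Hi<x) = begin
      depth x (withClique k T)                         ≡⟨ depth-++ x (stack peak k) (segments W) ⟩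
      depth x (stack peak k) ℕ.+ depth x (segments W)  ≡⟨ cong (depth x (stack peak k) ℕ.+_) (depth-uncovered wall-uncovered) ⟩
      depth x (stack peak k) ℕ.+ 0                     ≡⟨ ℕP.+-identityʳ _ ⟩
      depth x (stack peak k)                           ≤⟨ depth≤length x (stack peak k) ⟩
      length (stack peak k)                            ≡⟨ stack-length peak k ⟩
      k                                                ∎
      where
      open ℕP.≤-Reasoning
      wall-uncovered : All (λ s → ¬ Covers s x) (segments W)
      wall-uncovered = All.map (λ (_ , _ , r≤Hi) (_ , x≤r) → <⇒≱ Hi<x (ℚP.≤-trans x≤r r≤Hi)) (framed W)
    by-side (no Hi≮x) = begin
      depth x (withClique k T)                         ≡⟨ depth-++ x (stack peak k) (segments W) ⟩
      depth x (stack peak k) ℕ.+ depth x (segments W)  ≡⟨ cong (ℕ._+ depth x (segments W)) (depth-uncovered stack-uncovered) ⟩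
      depth x (segments W)                             ≤⟨ shallow x ⟩
      k                                                ∎
      where
      open ℕP.≤-Reasoning
      stack-uncovered : All (λ s → ¬ Covers s x) (stack peak k)
      stack-uncovered = All.map (λ (peak≤l , _ , _) (l≤x , _) → <⇒≱ Hi<peak (ℚP.≤-trans (ℚP.≤-trans peak≤l l≤x) (ℚP.≮⇒≥ Hi≮x)))
        (stack-within {peak} {peak} k ℚP.≤-refl ℚP.≤-refl)

  wall-depth≤ : ∀ {k T} → ℕ→ℚ T ≤ r * ℕ→ℚ k - β ⊎ T ≡ 0 → ∀ x → depth x (segments (thinWall T)) ℕ.≤ k
  wall-depth≤ (inj₂ refl) x = subst (ℕ._≤ _) (sym (colourless-empty (thinWall 0) x)) ℕ.z≤n
  wall-depth≤ {k} {T} (inj₁ T≤rk-β) x = ℕ→ℚ-cancel-≤ (ℚP.*-cancelˡ-≤-pos r (begin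
    r * ℕ→ℚ (depth x (segments (thinWall T)))  ≤⟨ thin (thinWall T) x ⟩
    ℕ→ℚ T + β                                  ≤⟨ ℚP.+-monoˡ-≤ β T≤rk-β ⟩
    r * ℕ→ℚ k - β + β                          ≡⟨ solve 2 (λ a b → a :- b :+ b := a) refl (r * ℕ→ℚ k) β ⟩
    r * ℕ→ℚ k                                  ∎))
    where open ℚP.≤-Reasoning
          open +-*-Solver

  wallFamily : WallFamily r (β + 1ℚ)
  wallFamily k = length (withClique k T) , toWall , (clique , clique≤depth (withClique-depth k T (wall-depth≤ T≤rk-β))) , enough-colours
    where
    T = proj₁ (ℕ-floor (r * ℕ→ℚ k - β))
    T≤rk-β = proj₁ (proj₂ (ℕ-floor (r * ℕ→ℚ k - β)))
    rk-β<T+1 = proj₂ (proj₂ (ℕ-floor (r * ℕ→ℚ k - β)))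
    open SegmentWall (withClique-isWall k T)
    column : Fin k → Segment
    column i = segment peak peak (suc (toℕ i))
    clique = overlapping⇒clique column (λ same → FinP.toℕ-injective (ℕP.suc-injective (cong colour same)))
      (λ i → AnyP.++⁺ˡ (∈-tabulate⁺ i)) (λ _ _ → ℚP.≤-refl , ℚP.≤-refl)
    enough-colours : r * ℕ→ℚ k - (β + 1ℚ) ≤ ℕ→ℚ (wallColors toWall)
    enough-colours = begin
      r * ℕ→ℚ k - (β + 1ℚ)     ≡⟨ solve 3 (λ a b c → a :- (b :+ c) := a :- b :+ (:- c)) refl (r * ℕ→ℚ k) β 1ℚ ⟩
      r * ℕ→ℚ k - β + - 1ℚ     <⟨ ℚP.+-monoˡ-< (- 1ℚ) (subst (r * ℕ→ℚ k - β <_) (ℕ→ℚ-homo-+ 1 T) rk-β<T+1) ⟩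
      1ℚ + ℕ→ℚ T + - 1ℚ        ≡⟨ solve 2 (λ a b → a :+ b :+ (:- a) := b) refl 1ℚ (ℕ→ℚ T) ⟩
      ℕ→ℚ T                    ≤⟨ ℕ→ℚ-mono-≤ (uses⇒colours≥ λ j 1≤j j≤T →
                                                  AnyP.++⁺ʳ (stack peak k) (uses (thinWall T) j 1≤j j≤T)) ⟩
      ℕ→ℚ (wallColors toWall)  ∎
      where open ℚP.≤-Reasoning
            open +-*-Solver

proposition2 : (r : ℚ) → 1ℚ ≤ r → Cap r →
    LeR r ×
    (∃ λ (b : ℚ) → ∀ (k : ℕ) → ∃ λ n → Σ (Wall n) λ W →
       CliqueNumber (Wall.rep W) k × (r * ℕ→ℚ k - b ≤ ℕ→ℚ (wallColors W)))
proposition2 r 1≤r cap = wallFamily⇒LeR wallFamily , _ , wallFamily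
  where
  0<r : 0ℚ < r
  0<r = ℚP.<-≤-trans (ℚP.positive⁻¹ 1ℚ) 1≤r
  open Construction 0<r (Normalise.closedCap cap)
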